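{- For every integer $n\ge 0$, \[ \sum_{k=0}^{\infty}(-1)^{\lceil k/2\rceil}\,\overline{p}_o\!\left(n-\frac{k(k+1)}{2}\right)=\begin{cases}1, & \text{if } n=\frac{m(m+1)}{2} \text{ for some integer } m\ge 0,\\ 0, & \text{otherwise}.\end{cases} \]
   Context: An overpartition of a nonnegative integer $n$ is a partition of $n$ in which the first occurrence of each part size may be overlined. $\overline{p}_o(n)$ denotes the number of overpartitions of $n$ into odd parts; equivalently $\sum_{n\ge0}\overline{p}_o(n)q^n=\frac{(-q;q^2)_\infty}{(q;q^2)_\infty}$, where $(a;q)_\infty=\prod_{k\ge1}(1-aq^{k-1})$. Convention: $\overline{p}_o(x)=0$ whenever $x$ is not a nonnegative integer. -}

module Defs where

open import Data.Nat using (ℕ; zero; suc; _+_; _*_; _∸_; _≤?_; _/_; _≡ᵇ_; _%_)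
open import Data.Bool using (if_then_else_)
open import Data.Integer as ℤ using (ℤ; +_; -_)
open import Relation.Nullary.Decidable using (does)

sumℕ : ℕ → (ℕ → ℕ) → ℕ
sumℕ zero    f = 0
sumℕ (suc K) f = sumℕ K f + f K

sumℤ : ℕ → (ℕ → ℤ) → ℤ
sumℤ zero    f = + 0
sumℤ (suc K) f = sumℤ K f ℤ.+ f K

-- opBounded j n = number of overpartitions of n all of whose parts are odd
-- and lie in {1, 3, ..., 2j-1}.  Combinatorially: for the largest allowed
-- part size s = 2j-1 either it does not occur, or it occurs with
-- multiplicity m ≥ 1 (m*s ≤ n), in which case its first occurrence is
-- overlined or not (factor 2); the rest is an overpartition of n - m*s
-- into odd parts ≤ 2j-3.
opBounded : ℕ → ℕ → ℕ
opBounded zero    n = if n ≡ᵇ 0 then 1 else 0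
opBounded (suc j) n =
  opBounded j n +
  2 * sumℕ n (λ i → let m = suc i ; s = 2 * j + 1 in
                     if does (m * s ≤? n) then opBounded j (n ∸ m * s) else 0)

-- Every part of an overpartition of n is ≤ n ≤ 2n-1 (n ≥ 1), so bounding
-- odd parts by 2n-1 loses nothing; for n = 0 the empty overpartition is counted.
pbarO : ℕ → ℕ
pbarO n = opBounded n n

tri : ℕ → ℕ
tri k = (k * suc k) / 2

-- (-1)^⌈k/2⌉ as an integer; ⌈k/2⌉ = (k+1)/2 (floor division)
signCeilHalf : ℕ → ℤ
signCeilHalf k = if ((suc k / 2) % 2) ≡ᵇ 0 then + 1 else - (+ 1)

-- the k-th summand  (-1)^⌈k/2⌉ p̄_o(n - k(k+1)/2),  with p̄_o(x) = 0 for x < 0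
term : ℕ → ℕ → ℤ
term n k = if does (tri k ≤? n) then signCeilHalf k ℤ.* (+ pbarO (n ∸ tri k)) else + 0

{-# OPTIONS --safe #-}
-- Write P = Σ p̄ₒ(n) qⁿ and index the triangular numbers by n ∈ ℤ through k = 2n (n ≥ 0) and
-- k = −2n − 1 (n < 0), which turns k(k+1)/2 into n(2n+1) and (−1)^⌈k/2⌉ into (−1)ⁿ. The theorem
-- then says P · θ₋ = θ₊ for the theta series θ± = Σₙ (±1)ⁿ q^{n(2n+1)}.
-- Up to degree m the finite triple product ∏_{i≤m} (1 + z q^{4i+3}) (1 + z⁻¹ q^{4i+1}) equals
-- C₀(q) · Σₙ zⁿ q^{n(2n+1)}, C₀ being its z⁰-coefficient, by its functional equation under
-- z ↦ z q⁴. At z = ±1 it becomes ∏ (1 ± q^{2i+1}) = C₀ θ±, and P · ∏ (1 − q^{2i+1}) =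
-- ∏ (1 + q^{2i+1}) by the recursion defining p̄ₒ. Hence C₀ P θ₋ = C₀ θ₊, and C₀ cancels because
-- its constant term is 1.
module Submission where

open import Defs
open import Data.Bool using (true; false; if_then_else_)
open import Data.Empty using (⊥-elim)
open import Data.Integer as ℤ using (ℤ; +_; -[1+_]; -_; _+_; _-_; _*_; _^_)
import Data.Integer.Properties as ℤP
open import Algebra.Properties.AbelianGroup ℤP.+-0-abelianGroup using (∙-cancelˡ)
open import Algebra.Properties.CommutativeSemigroup ℤP.+-commutativeSemigroup using (interchange)
open import Data.Integer.Tactic.RingSolver using (solve-∀)
open import Data.Nat as ℕ using (ℕ; zero; suc; z≤n; s≤s; _∸_; _≤?_; _<_; _/_; _%_; _≡ᵇ_)
import Data.Nat.DivMod as DM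
open import Data.Nat.Induction using (<-rec)
import Data.Nat.Properties as ℕP
import Data.Nat.Tactic.RingSolver as NS
open import Data.Product using (_×_; _,_; Σ; ∃)
open import Data.Sum using (_⊎_; inj₁; inj₂; swap)
open import Function using (_∘_)
open import Relation.Binary.Definitions using (tri<; tri≈; tri>)
open import Relation.Binary.PropositionalEquality
  using (_≡_; _≢_; refl; sym; trans; cong; cong₂; subst; _≗_; module ≡-Reasoning)
open import Relation.Nullary using (¬_; Dec; yes; no; does)
open import Relation.Nullary.Decidable using (dec-true; dec-false)

if-yes : ∀ {P A : Set} (d : Dec P) {x y : A} → P → (if does d then x else y) ≡ x
if-yes d p rewrite dec-true d p = refl

if-no : ∀ {P A : Set} (d : Dec P) {x y : A} → ¬ P → (if does d then x else y) ≡ y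
if-no d ¬p rewrite dec-false d ¬p = refl

𝟙 : ∀ {P : Set} → Dec P → ℤ
𝟙 d = if does d then + 1 else + 0

+m-+n-negative : ∀ {m n} → m < n → + m - + n ≡ -[1+ (n ∸ suc m) ]
+m-+n-negative {m} {suc n} (s≤s m≤n) =
  trans (cong (λ x → + m - + suc x) (sym (ℕP.m+[n∸m]≡n m≤n))) (cancel (+ m) (+ (n ∸ m)))
  where
  cancel : ∀ M D → M - (+ 1 + (M + D)) ≡ - (+ 1 + D)
  cancel = solve-∀

sum-cong : ∀ K {f g : ℕ → ℤ} → (∀ i → i < K → f i ≡ g i) → sumℤ K f ≡ sumℤ K g
sum-cong zero    eq = refl
sum-cong (suc K) eq = cong₂ _+_ (sum-cong K (λ i i<K → eq i (ℕP.m<n⇒m<1+n i<K))) (eq K ℕP.≤-refl)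

sum-ext : ∀ K {f g : ℕ → ℤ} → f ≗ g → sumℤ K f ≡ sumℤ K g
sum-ext K eq = sum-cong K (λ i _ → eq i)

sum-zero : ∀ K {f : ℕ → ℤ} → (∀ i → i < K → f i ≡ + 0) → sumℤ K f ≡ + 0
sum-zero zero    eq = refl
sum-zero (suc K) eq =
  cong₂ _+_ (sum-zero K (λ i i<K → eq i (ℕP.m<n⇒m<1+n i<K))) (eq K ℕP.≤-refl)

sum-+ : ∀ K (f g : ℕ → ℤ) → sumℤ K (λ i → f i + g i) ≡ sumℤ K f + sumℤ K g
sum-+ zero    f g = refl
sum-+ (suc K) f g = trans (cong (_+ (f K + g K)) (sum-+ K f g)) (interchange (sumℤ K f) (sumℤ K g) (f K) (g K))

sum-*ˡ : ∀ K (c : ℤ) (f : ℕ → ℤ) → sumℤ K (λ i → c * f i) ≡ c * sumℤ K f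
sum-*ˡ zero    c f = sym (ℤP.*-zeroʳ c)
sum-*ˡ (suc K) c f = trans (cong (_+ c * f K) (sum-*ˡ K c f)) (sym (ℤP.*-distribˡ-+ c _ _))

sum-*ʳ : ∀ K (c : ℤ) (f : ℕ → ℤ) → sumℤ K (λ i → f i * c) ≡ sumℤ K f * c
sum-*ʳ K c f = begin
  sumℤ K (λ i → f i * c) ≡⟨ sum-ext K (λ i → ℤP.*-comm (f i) c) ⟩
  sumℤ K (λ i → c * f i) ≡⟨ sum-*ˡ K c f ⟩
  c * sumℤ K f           ≡⟨ ℤP.*-comm c _ ⟩
  sumℤ K f * c           ∎
  where open ≡-Reasoning

sum-head : ∀ K (f : ℕ → ℤ) → sumℤ (suc K) f ≡ f 0 + sumℤ K (λ i → f (suc i))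
sum-head zero    f = ℤP.+-comm (+ 0) (f 0)
sum-head (suc K) f = trans (cong (_+ f (suc K)) (sum-head K f)) (ℤP.+-assoc (f 0) _ _)

sum-split : ∀ m n (f : ℕ → ℤ) → sumℤ (m ℕ.+ n) f ≡ sumℤ m f + sumℤ n (λ i → f (m ℕ.+ i))
sum-split zero    n f = sym (ℤP.+-identityˡ _)
sum-split (suc m) n f = begin
  sumℤ (suc m ℕ.+ n) f
    ≡⟨ sum-head (m ℕ.+ n) f ⟩
  f 0 + sumℤ (m ℕ.+ n) (λ i → f (suc i))
    ≡⟨ cong (λ x → f 0 + x) (sum-split m n (λ i → f (suc i))) ⟩
  f 0 + (sumℤ m (λ i → f (suc i)) + sumℤ n (λ i → f (suc m ℕ.+ i)))
    ≡⟨ sym (ℤP.+-assoc (f 0) _ _) ⟩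
  f 0 + sumℤ m (λ i → f (suc i)) + sumℤ n (λ i → f (suc m ℕ.+ i))
    ≡⟨ cong (_+ sumℤ n (λ i → f (suc m ℕ.+ i))) (sym (sum-head m f)) ⟩
  sumℤ (suc m) f + sumℤ n (λ i → f (suc m ℕ.+ i)) ∎
  where open ≡-Reasoning

sum-comm : ∀ m n (F : ℕ → ℕ → ℤ) →
  sumℤ m (λ i → sumℤ n (F i)) ≡ sumℤ n (λ j → sumℤ m (λ i → F i j))
sum-comm zero    n F = sym (sum-zero n (λ _ _ → refl))
sum-comm (suc m) n F =
  trans (cong (_+ sumℤ n (F m)) (sum-comm m n F)) (sym (sum-+ n (λ j → sumℤ m (λ i → F i j)) (F m)))

sum-reverse : ∀ K (f : ℕ → ℤ) → sumℤ K f ≡ sumℤ K (λ i → f (K ∸ suc i))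
sum-reverse zero    f = refl
sum-reverse (suc K) f = begin
  sumℤ K f + f K                          ≡⟨ cong (_+ f K) (sum-reverse K f) ⟩
  sumℤ K (λ i → f (K ∸ suc i)) + f K      ≡⟨ ℤP.+-comm _ (f K) ⟩
  f K + sumℤ K (λ i → f (K ∸ suc i))      ≡⟨ sym (sum-head K (λ i → f (suc K ∸ suc i))) ⟩
  sumℤ (suc K) (λ i → f (suc K ∸ suc i))  ∎
  where open ≡-Reasoning

sum-single : ∀ K a {f : ℕ → ℤ} → a < K → (∀ i → i < K → i ≢ a → f i ≡ + 0) → sumℤ K f ≡ f a
sum-single (suc K) a {f} a<1+K vanish with a ℕ.≟ K
... | yes refl = begin
  sumℤ K f + f K ≡⟨ cong (_+ f K) (sum-zero K (λ i i<K → vanish i (ℕP.m<n⇒m<1+n i<K) (ℕP.<⇒≢ i<K))) ⟩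
  + 0 + f K      ≡⟨ ℤP.+-identityˡ (f K) ⟩
  f K            ∎
  where open ≡-Reasoning
... | no a≢K = begin
  sumℤ K f + f K ≡⟨ cong₂ _+_ (sum-single K a a<K (λ i i<K → vanish i (ℕP.m<n⇒m<1+n i<K)))
                              (vanish K ℕP.≤-refl (a≢K ∘ sym)) ⟩
  f a + + 0      ≡⟨ ℤP.+-identityʳ (f a) ⟩
  f a            ∎
  where
  open ≡-Reasoning
  a<K = ℕP.≤∧≢⇒< (ℕP.≤-pred a<1+K) a≢K

sum-triangle : ∀ n (F : ℕ → ℕ → ℤ) →
  sumℤ (suc n) (λ i → sumℤ (suc i) (F i)) ≡
  sumℤ (suc n) (λ j → sumℤ (suc (n ∸ j)) (λ k → F (j ℕ.+ k) j))
sum-triangle zero    F = refl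
sum-triangle (suc n) F = begin
  sumℤ (suc n) (λ i → sumℤ (suc i) (F i)) + sumℤ (2 ℕ.+ n) (F (suc n))
    ≡⟨ cong (_+ sumℤ (2 ℕ.+ n) (F (suc n))) (trans (sum-triangle n F) (sym extend)) ⟩
  sumℤ (2 ℕ.+ n) column + sumℤ (2 ℕ.+ n) (F (suc n))
    ≡⟨ sym (sum-+ (2 ℕ.+ n) column (F (suc n))) ⟩
  sumℤ (2 ℕ.+ n) (λ j → column j + F (suc n) j)
    ≡⟨ sum-cong (2 ℕ.+ n) (λ j j<2+n → cong (λ m → column j + F m j) (sym (ℕP.m+[n∸m]≡n (ℕP.≤-pred j<2+n)))) ⟩
  sumℤ (2 ℕ.+ n) (λ j → sumℤ (suc (suc n ∸ j)) (λ k → F (j ℕ.+ k) j)) ∎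
  where
  open ≡-Reasoning
  column : ℕ → ℤ
  column j = sumℤ (suc n ∸ j) (λ k → F (j ℕ.+ k) j)
  extend : sumℤ (2 ℕ.+ n) column ≡ sumℤ (suc n) (λ j → sumℤ (suc (n ∸ j)) (λ k → F (j ℕ.+ k) j))
  extend = begin
    sumℤ (suc n) column + sumℤ (n ∸ n) (λ k → F (suc (n ℕ.+ k)) (suc n))
      ≡⟨ cong (λ m → sumℤ (suc n) column + sumℤ m (λ k → F (suc (n ℕ.+ k)) (suc n))) (ℕP.n∸n≡0 n) ⟩
    sumℤ (suc n) column + + 0
      ≡⟨ ℤP.+-identityʳ _ ⟩
    sumℤ (suc n) column
      ≡⟨ sum-cong (suc n) (λ j j<1+n → cong (λ m → sumℤ m (λ k → F (j ℕ.+ k) j)) (ℕP.+-∸-assoc 1 (ℕP.≤-pred j<1+n))) ⟩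
    sumℤ (suc n) (λ j → sumℤ (suc (n ∸ j)) (λ k → F (j ℕ.+ k) j)) ∎

sumℕ-sumℤ : ∀ K (f : ℕ → ℕ) → + sumℕ K f ≡ sumℤ K (λ i → + f i)
sumℕ-sumℤ zero    f = refl
sumℕ-sumℤ (suc K) f = cong (_+ + f K) (sumℕ-sumℤ K f)

window : ℤ → ℕ → (ℤ → ℤ) → ℤ
window lo len f = sumℤ len (λ i → f (lo + + i))

window-ext : ∀ lo len {f g : ℤ → ℤ} → f ≗ g → window lo len f ≡ window lo len g
window-ext lo len eq = sum-ext len (λ i → eq (lo + + i))

window-split : ∀ lo d len f → window lo (d ℕ.+ len) f ≡ window lo d f + window (lo + + d) len f
window-split lo d len f = trans (sum-split d len _)
  (cong (λ x → window lo d f + x) (sum-ext len (λ i → cong f (sym (ℤP.+-assoc lo (+ d) (+ i))))))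

window-translate : ∀ lo len f k → window lo len (λ n → f (n + k)) ≡ window (lo + k) len f
window-translate lo len f k = sum-ext len (λ i → cong f (reorder lo (+ i) k))
  where
  reorder : ∀ a b c → a + b + c ≡ a + c + b
  reorder = solve-∀

window-single : ∀ lo f → window lo 1 f ≡ f lo
window-single lo f = trans (ℤP.+-identityˡ _) (cong f (ℤP.+-identityʳ lo))

window-trimˡ : ∀ lo d len f → (∀ i → i < d → f (lo + + i) ≡ + 0) → window lo (d ℕ.+ len) f ≡ window (lo + + d) len f
window-trimˡ lo d len f vanish =
  trans (window-split lo d len f) (trans (cong (_+ window (lo + + d) len f) (sum-zero d vanish)) (ℤP.+-identityˡ _))

window-trimʳ : ∀ lo len d f → (∀ i → i < d → f (lo + + len + + i) ≡ + 0) → window lo (len ℕ.+ d) f ≡ window lo len f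
window-trimʳ lo len d f vanish =
  trans (window-split lo len d f) (trans (cong (λ x → window lo len f + x) (sum-zero d vanish)) (ℤP.+-identityʳ _))

centredSum : ℕ → (ℤ → ℤ) → ℤ
centredSum R f = window (- + R) (suc (R ℕ.+ R)) f

VanishesBeyond : (ℤ → ℤ) → ℕ → Set
VanishesBeyond f r = (∀ j → f (+ (suc r ℕ.+ j)) ≡ + 0) × (∀ j → f (- + (suc r ℕ.+ j)) ≡ + 0)

centredSum-ext : ∀ R {f g : ℤ → ℤ} → f ≗ g → centredSum R f ≡ centredSum R g
centredSum-ext R = window-ext (- + R) (suc (R ℕ.+ R))

centredSum-+ : ∀ R f g → centredSum R (λ n → f n + g n) ≡ centredSum R f + centredSum R g
centredSum-+ R f g = sum-+ (suc (R ℕ.+ R)) (λ i → f (- + R + + i)) (λ i → g (- + R + + i))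

centredSum-*ˡ : ∀ R c f → centredSum R (λ n → c * f n) ≡ c * centredSum R f
centredSum-*ˡ R c f = sum-*ˡ (suc (R ℕ.+ R)) c (λ i → f (- + R + + i))

centredSum-zero : ∀ R {f} → (∀ n → f n ≡ + 0) → centredSum R f ≡ + 0
centredSum-zero R vanish = sum-zero (suc (R ℕ.+ R)) (λ i _ → vanish (- + R + + i))

centredSum-suc : ∀ R f → centredSum (suc R) f ≡ f (- + suc R) + centredSum R f + f (+ suc R)
centredSum-suc R f = begin
  window (- + suc R) (suc (suc R ℕ.+ suc R)) f
    ≡⟨ cong (λ len → window (- + suc R) len f) (length R) ⟩
  window (- + suc R) (1 ℕ.+ (suc (R ℕ.+ R) ℕ.+ 1)) f
    ≡⟨ window-split (- + suc R) 1 (suc (R ℕ.+ R) ℕ.+ 1) f ⟩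
  window (- + suc R) 1 f + window (- + suc R + + 1) (suc (R ℕ.+ R) ℕ.+ 1) f
    ≡⟨ cong₂ _+_ (window-single (- + suc R) f) (window-split (- + suc R + + 1) (suc (R ℕ.+ R)) 1 f) ⟩
  f (- + suc R) + (window (- + suc R + + 1) (suc (R ℕ.+ R)) f + window (- + suc R + + 1 + + suc (R ℕ.+ R)) 1 f)
    ≡⟨ cong₂ (λ lo x → f (- + suc R) + (window lo (suc (R ℕ.+ R)) f + x)) (left (+ R))
             (trans (window-single _ f) (cong f (right (+ R)))) ⟩
  f (- + suc R) + (centredSum R f + f (+ suc R))
    ≡⟨ sym (ℤP.+-assoc (f (- + suc R)) _ _) ⟩
  f (- + suc R) + centredSum R f + f (+ suc R) ∎
  where
  open ≡-Reasoning
  length : ∀ r → suc (suc r ℕ.+ suc r) ≡ 1 ℕ.+ (suc (r ℕ.+ r) ℕ.+ 1)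
  length = NS.solve-∀
  left : ∀ R → - (+ 1 + R) + + 1 ≡ - R
  left = solve-∀
  right : ∀ R → - (+ 1 + R) + + 1 + (+ 1 + (R + R)) ≡ + 1 + R
  right = solve-∀

centredSum-enlarge : ∀ {f r} → VanishesBeyond f r → ∀ {R} → r ℕ.≤ R → centredSum R f ≡ centredSum r f
centredSum-enlarge {f} {r} (above , below) {R} r≤R =
  trans (cong (λ R → centredSum R f) (sym (ℕP.m∸n+n≡m r≤R))) (enlarge (R ∸ r))
  where
  enlarge : ∀ k → centredSum (k ℕ.+ r) f ≡ centredSum r f
  enlarge zero    = refl
  enlarge (suc k) = begin
    centredSum (suc k ℕ.+ r) f
      ≡⟨ centredSum-suc (k ℕ.+ r) f ⟩
    f (- + suc (k ℕ.+ r)) + centredSum (k ℕ.+ r) f + f (+ suc (k ℕ.+ r))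
      ≡⟨ cong₂ (λ x y → x + centredSum (k ℕ.+ r) f + y)
               (trans (cong (λ i → f (- + suc i)) (ℕP.+-comm k r)) (below k))
               (trans (cong (λ i → f (+ suc i)) (ℕP.+-comm k r)) (above k)) ⟩
    + 0 + centredSum (k ℕ.+ r) f + + 0
      ≡⟨ trans (ℤP.+-identityʳ _) (ℤP.+-identityˡ _) ⟩
    centredSum (k ℕ.+ r) f
      ≡⟨ enlarge k ⟩
    centredSum r f ∎
    where open ≡-Reasoning

vanishesBeyond-*ˡ : ∀ (g : ℤ → ℤ) {f r} → VanishesBeyond f r → VanishesBeyond (λ n → g n * f n) r
vanishesBeyond-*ˡ g {f} {r} (above , below) =
  (λ j → trans (cong (g (+ (suc r ℕ.+ j)) *_) (above j)) (ℤP.*-zeroʳ (g (+ (suc r ℕ.+ j))))) ,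
  (λ j → trans (cong (g (- + (suc r ℕ.+ j)) *_) (below j)) (ℤP.*-zeroʳ (g (- + (suc r ℕ.+ j)))))

vanishesBeyond-translate⁺ : ∀ {f r} → VanishesBeyond f r → VanishesBeyond (λ n → f (n + + 1)) (suc r)
vanishesBeyond-translate⁺ {f} {r} (above , below) =
  (λ j → trans (cong f (outer (+ r) (+ j))) (above (2 ℕ.+ j))) ,
  (λ j → trans (cong f (inner (+ r) (+ j))) (below j))
  where
  outer : ∀ R J → + 1 + (+ 1 + (R + J)) + + 1 ≡ + 1 + (R + (+ 2 + J))
  outer = solve-∀
  inner : ∀ R J → - (+ 1 + (+ 1 + (R + J))) + + 1 ≡ - (+ 1 + (R + J))
  inner = solve-∀

vanishesBeyond-translate⁻ : ∀ {f r} → VanishesBeyond f r → VanishesBeyond (λ n → f (n - + 1)) (suc r)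
vanishesBeyond-translate⁻ {f} {r} (above , below) =
  (λ j → trans (cong f (inner (+ r) (+ j))) (above j)) ,
  (λ j → trans (cong f (outer (+ r) (+ j))) (below (2 ℕ.+ j)))
  where
  inner : ∀ R J → + 1 + (+ 1 + (R + J)) - + 1 ≡ + 1 + (R + J)
  inner = solve-∀
  outer : ∀ R J → - (+ 1 + (+ 1 + (R + J))) - + 1 ≡ - (+ 1 + (R + (+ 2 + J)))
  outer = solve-∀

centredSum-translate⁺ : ∀ f {r R} → VanishesBeyond f r → r < R →
  centredSum R (λ n → f (n + + 1)) ≡ centredSum r f
centredSum-translate⁺ f {r} {R} vanish@(above , _) r<R = begin
  centredSum R (λ n → f (n + + 1))
    ≡⟨ centredSum-enlarge {f = λ n → f (n + + 1)} (vanishesBeyond-translate⁺ {f} {r} vanish) r<R ⟩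
  window (- + suc r) (suc (suc r ℕ.+ suc r)) (λ n → f (n + + 1))
    ≡⟨ window-translate (- + suc r) (suc (suc r ℕ.+ suc r)) f (+ 1) ⟩
  window (- + suc r + + 1) (suc (suc r ℕ.+ suc r)) f
    ≡⟨ cong₂ (λ lo len → window lo len f) (start (+ r)) (length r) ⟩
  window (- + r) (suc (r ℕ.+ r) ℕ.+ 2) f
    ≡⟨ window-trimʳ (- + r) (suc (r ℕ.+ r)) 2 f (λ i _ → trans (cong f (end (+ r) (+ i))) (above i)) ⟩
  centredSum r f ∎
  where
  open ≡-Reasoning
  length : ∀ r → suc (suc r ℕ.+ suc r) ≡ suc (r ℕ.+ r) ℕ.+ 2
  length = NS.solve-∀
  start : ∀ R → - (+ 1 + R) + + 1 ≡ - R
  start = solve-∀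
  end : ∀ R I → - R + (+ 1 + (R + R)) + I ≡ + 1 + (R + I)
  end = solve-∀

centredSum-translate⁻ : ∀ f {r R} → VanishesBeyond f r → r < R →
  centredSum R (λ n → f (n - + 1)) ≡ centredSum r f
centredSum-translate⁻ f {r} {R} vanish@(_ , below) r<R = begin
  centredSum R (λ n → f (n - + 1))
    ≡⟨ centredSum-enlarge {f = λ n → f (n - + 1)} (vanishesBeyond-translate⁻ {f} {r} vanish) r<R ⟩
  window (- + suc r) (suc (suc r ℕ.+ suc r)) (λ n → f (n - + 1))
    ≡⟨ window-translate (- + suc r) (suc (suc r ℕ.+ suc r)) f (- + 1) ⟩
  window (- + suc r - + 1) (suc (suc r ℕ.+ suc r)) f
    ≡⟨ cong (λ len → window (- + suc r - + 1) len f) (length r) ⟩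
  window (- + suc r - + 1) (2 ℕ.+ suc (r ℕ.+ r)) f
    ≡⟨ window-trimˡ (- + suc r - + 1) 2 (suc (r ℕ.+ r)) f outside ⟩
  window (- + suc r - + 1 + + 2) (suc (r ℕ.+ r)) f
    ≡⟨ cong (λ lo → window lo (suc (r ℕ.+ r)) f) (start (+ r)) ⟩
  centredSum r f ∎
  where
  open ≡-Reasoning
  length : ∀ r → suc (suc r ℕ.+ suc r) ≡ 2 ℕ.+ suc (r ℕ.+ r)
  length = NS.solve-∀
  start : ∀ R → - (+ 1 + R) - + 1 + + 2 ≡ - R
  start = solve-∀
  first : ∀ R → - (+ 1 + R) - + 1 + + 0 ≡ - (+ 1 + (R + + 1))
  first = solve-∀
  second : ∀ R → - (+ 1 + R) - + 1 + + 1 ≡ - (+ 1 + (R + + 0))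
  second = solve-∀
  outside : ∀ i → i < 2 → f (- + suc r - + 1 + + i) ≡ + 0
  outside zero          _ = trans (cong f (first (+ r))) (below 1)
  outside (suc zero)    _ = trans (cong f (second (+ r))) (below 0)
  outside (suc (suc i)) (s≤s (s≤s ()))

centredSum-index : ∀ R n → ℤ.∣ n ∣ ℕ.≤ R → Σ ℕ λ i → i < suc (R ℕ.+ R) × - + R + + i ≡ n
centredSum-index R (+ k)    k≤R = R ℕ.+ k , s≤s (ℕP.+-monoʳ-≤ R k≤R) , cancel (+ R) (+ k)
  where
  cancel : ∀ R K → - R + (R + K) ≡ K
  cancel = solve-∀
centredSum-index R -[1+ k ] k<R = R ∸ suc k , s≤s (ℕP.≤-trans (ℕP.m∸n≤m R (suc k)) (ℕP.m≤m+n R R)) ,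
  trans (cong (λ x → - + R + x) (sym (trans (ℤP.m-n≡m⊖n R (suc k)) (ℤP.⊖-≥ k<R)))) (cancel (+ R) (+ suc k))
  where
  cancel : ∀ R K → - R + (R - K) ≡ - K
  cancel = solve-∀

centredSum-single : ∀ R {f} n₀ → ℤ.∣ n₀ ∣ ℕ.≤ R → (∀ n → n ≢ n₀ → f n ≡ + 0) → centredSum R f ≡ f n₀
centredSum-single R {f} n₀ ∣n₀∣≤R off with centredSum-index R n₀ ∣n₀∣≤R
... | i₀ , i₀<len , at-n₀ = trans (sum-single (suc (R ℕ.+ R)) i₀ i₀<len off-i₀) (cong f at-n₀)
  where
  off-i₀ : ∀ i → i < suc (R ℕ.+ R) → i ≢ i₀ → f (- + R + + i) ≡ + 0
  off-i₀ i _ i≢i₀ = off _ (λ at-n₀′ → i≢i₀ (ℤP.+-injective (∙-cancelˡ (- + R) (+ i) (+ i₀) (trans at-n₀′ (sym at-n₀)))))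

-- Formal power series

Series : Set
Series = ℕ → ℤ

infixl 7 _⊛_

_⊛_ : Series → Series → Series
(f ⊛ g) n = sumℤ (suc n) (λ i → f i * g (n ∸ i))

⊛-cong-≤ : ∀ n {f f′ g g′ : Series} → (∀ i → i ℕ.≤ n → f i ≡ f′ i) → (∀ i → i ℕ.≤ n → g i ≡ g′ i) →
  (f ⊛ g) n ≡ (f′ ⊛ g′) n
⊛-cong-≤ n eqf eqg =
  sum-cong (suc n) (λ i i≤n → cong₂ _*_ (eqf i (ℕP.≤-pred i≤n)) (eqg (n ∸ i) (ℕP.m∸n≤m n i)))

⊛-cong : ∀ {f f′ g g′ : Series} → f ≗ f′ → g ≗ g′ → f ⊛ g ≗ f′ ⊛ g′
⊛-cong eqf eqg n = ⊛-cong-≤ n (λ i _ → eqf i) (λ i _ → eqg i)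

⊛-congˡ : ∀ {f f′ : Series} g → f ≗ f′ → f ⊛ g ≗ f′ ⊛ g
⊛-congˡ g eqf = ⊛-cong {g = g} eqf (λ _ → refl)

⊛-congʳ : ∀ f {g g′ : Series} → g ≗ g′ → f ⊛ g ≗ f ⊛ g′
⊛-congʳ f = ⊛-cong {f = f} (λ _ → refl)

⊛-comm : ∀ f g → f ⊛ g ≗ g ⊛ f
⊛-comm f g n = trans (sum-reverse (suc n) _) (sum-cong (suc n) reflect)
  where
  reflect : ∀ i → i < suc n → f (n ∸ i) * g (n ∸ (n ∸ i)) ≡ g i * f (n ∸ i)
  reflect i i<1+n = trans (cong (λ j → f (n ∸ i) * g j) (ℕP.m∸[m∸n]≡n (ℕP.≤-pred i<1+n))) (ℤP.*-comm (f (n ∸ i)) (g i))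

⊛-assoc : ∀ f g h → (f ⊛ g) ⊛ h ≗ f ⊛ (g ⊛ h)
⊛-assoc f g h n = begin
  sumℤ (suc n) (λ i → (f ⊛ g) i * h (n ∸ i))
    ≡⟨ sum-ext (suc n) (λ i → sym (sum-*ʳ (suc i) (h (n ∸ i)) (λ j → f j * g (i ∸ j)))) ⟩
  sumℤ (suc n) (λ i → sumℤ (suc i) (λ j → f j * g (i ∸ j) * h (n ∸ i)))
    ≡⟨ sum-triangle n (λ i j → f j * g (i ∸ j) * h (n ∸ i)) ⟩
  sumℤ (suc n) (λ j → sumℤ (suc (n ∸ j)) (λ k → f j * g (j ℕ.+ k ∸ j) * h (n ∸ (j ℕ.+ k))))
    ≡⟨ sum-ext (suc n) (λ j → sum-ext (suc (n ∸ j)) (reassociate j)) ⟩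
  sumℤ (suc n) (λ j → sumℤ (suc (n ∸ j)) (λ k → f j * (g k * h (n ∸ j ∸ k))))
    ≡⟨ sum-ext (suc n) (λ j → sum-*ˡ (suc (n ∸ j)) (f j) (λ k → g k * h (n ∸ j ∸ k))) ⟩
  sumℤ (suc n) (λ j → f j * (g ⊛ h) (n ∸ j)) ∎
  where
  open ≡-Reasoning
  reassociate : ∀ j k → f j * g (j ℕ.+ k ∸ j) * h (n ∸ (j ℕ.+ k)) ≡ f j * (g k * h (n ∸ j ∸ k))
  reassociate j k rewrite ℕP.m+n∸m≡n j k | ℕP.∸-+-assoc n j k = ℤP.*-assoc (f j) (g k) _

⊛-exchange : ∀ f g h → f ⊛ (g ⊛ h) ≗ g ⊛ (f ⊛ h)
⊛-exchange f g h n = begin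
  (f ⊛ (g ⊛ h)) n ≡⟨ sym (⊛-assoc f g h n) ⟩
  (f ⊛ g ⊛ h) n   ≡⟨ ⊛-congˡ h (⊛-comm f g) n ⟩
  (g ⊛ f ⊛ h) n   ≡⟨ ⊛-assoc g f h n ⟩
  (g ⊛ (f ⊛ h)) n ∎
  where open ≡-Reasoning

one : Series
one zero    = + 1
one (suc _) = + 0

⊛-identityˡ : ∀ f → one ⊛ f ≗ f
⊛-identityˡ f n = begin
  (one ⊛ f) n                               ≡⟨ sum-head n _ ⟩
  + 1 * f n + sumℤ n (λ i → + 0 * f (n ∸ suc i)) ≡⟨ cong (λ x → + 1 * f n + x) (sum-zero n (λ _ _ → refl)) ⟩
  + 1 * f n + + 0                           ≡⟨ ℤP.+-identityʳ _ ⟩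
  + 1 * f n                                 ≡⟨ ℤP.*-identityˡ (f n) ⟩
  f n                                       ∎
  where open ≡-Reasoning

shift : ℕ → Series → Series
shift s f w = if does (s ≤? w) then f (w ∸ s) else + 0

shift-≤ : ∀ {s w} f → s ℕ.≤ w → shift s f w ≡ f (w ∸ s)
shift-≤ {s} {w} f = if-yes (s ≤? w)

shift-≰ : ∀ {s w} f → ¬ s ℕ.≤ w → shift s f w ≡ + 0
shift-≰ {s} {w} f = if-no (s ≤? w)

one-≢0 : ∀ {n} → n ≢ 0 → one n ≡ + 0
one-≢0 {zero}  n≢0 = ⊥-elim (n≢0 refl)
one-≢0 {suc n} _   = refl

shift-one-≢ : ∀ {s i} → i ≢ s → shift s one i ≡ + 0
shift-one-≢ {s} {i} i≢s with s ≤? i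
... | no s≰i  = shift-≰ one s≰i
... | yes s≤i = trans (shift-≤ one s≤i) (one-≢0 (λ i∸s≡0 → i≢s (ℕP.≤-antisym (ℕP.m∸n≡0⇒m≤n i∸s≡0) s≤i)))

shift-one-⊛ : ∀ s f → shift s one ⊛ f ≗ shift s f
shift-one-⊛ s f w with s ≤? w
... | yes s≤w = begin
  (shift s one ⊛ f) w          ≡⟨ sum-single (suc w) s (s≤s s≤w) (λ i _ i≢s → cong (_* f (w ∸ i)) (shift-one-≢ {s} {i} i≢s)) ⟩
  shift s one s * f (w ∸ s)    ≡⟨ cong (_* f (w ∸ s)) (trans (shift-≤ {s} one ℕP.≤-refl) (cong one (ℕP.n∸n≡0 s))) ⟩
  + 1 * f (w ∸ s)              ≡⟨ ℤP.*-identityˡ _ ⟩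
  f (w ∸ s)                    ≡⟨ sym (shift-≤ f s≤w) ⟩
  shift s f w                  ∎
  where open ≡-Reasoning
... | no s≰w = trans (sum-zero (suc w) vanish) (sym (shift-≰ f s≰w))
  where
  vanish : ∀ i → i < suc w → shift s one i * f (w ∸ i) ≡ + 0
  vanish i i<1+w = cong (_* f (w ∸ i)) (shift-one-≢ {s} {i} (λ { refl → s≰w (ℕP.≤-pred i<1+w) }))

shift-cong : ∀ s {f g : Series} → f ≗ g → shift s f ≗ shift s g
shift-cong s eq w = cong (λ x → if does (s ≤? w) then x else + 0) (eq (w ∸ s))

shift-+ : ∀ s (f g : Series) → shift s (λ v → f v + g v) ≗ λ w → shift s f w + shift s g w
shift-+ s f g w with s ℕ.≤ᵇ w
... | true  = refl
... | false = refl

shift-*ˡ : ∀ s c (f : Series) → shift s (λ v → c * f v) ≗ λ w → c * shift s f w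
shift-*ˡ s c f w with s ℕ.≤ᵇ w
... | true  = refl
... | false = sym (ℤP.*-zeroʳ c)

binomial : ℤ → ℕ → Series
binomial ε s w = one w + ε * shift s one w

binomial-⊛ : ∀ ε s f → binomial ε s ⊛ f ≗ λ w → f w + ε * shift s f w
binomial-⊛ ε s f w = begin
  sumℤ (suc w) (λ i → (one i + ε * shift s one i) * f (w ∸ i))
    ≡⟨ sum-ext (suc w) (λ i → ℤP.*-distribʳ-+ (f (w ∸ i)) (one i) _) ⟩
  sumℤ (suc w) (λ i → one i * f (w ∸ i) + ε * shift s one i * f (w ∸ i))
    ≡⟨ sum-+ (suc w) _ _ ⟩
  (one ⊛ f) w + sumℤ (suc w) (λ i → ε * shift s one i * f (w ∸ i))
    ≡⟨ cong₂ _+_ (⊛-identityˡ f w) (sum-ext (suc w) (λ i → ℤP.*-assoc ε (shift s one i) _)) ⟩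
  f w + sumℤ (suc w) (λ i → ε * (shift s one i * f (w ∸ i)))
    ≡⟨ cong (λ x → f w + x) (sum-*ˡ (suc w) ε _) ⟩
  f w + ε * (shift s one ⊛ f) w
    ≡⟨ cong (λ x → f w + ε * x) (shift-one-⊛ s f w) ⟩
  f w + ε * shift s f w ∎
  where open ≡-Reasoning

oddProduct : ℤ → ℕ → Series
oddProduct ε zero    = one
oddProduct ε (suc j) = binomial ε (1 ℕ.+ j ℕ.* 2) ⊛ oddProduct ε j

⊛-cancelˡ : ∀ a {f g : Series} M → a 0 ≡ + 1 →
  (∀ v → v ℕ.≤ M → (a ⊛ f) v ≡ (a ⊛ g) v) → ∀ v → v ℕ.≤ M → f v ≡ g v
⊛-cancelˡ a {f} {g} M a₀≡1 eq = <-rec _ step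
  where
  lower : Series → ℕ → ℤ
  lower h v = sumℤ v (λ i → h i * a (v ∸ i))
  step : ∀ v → (∀ {u} → u < v → u ℕ.≤ M → f u ≡ g u) → v ℕ.≤ M → f v ≡ g v
  step v below v≤M = begin
    f v                ≡⟨ sym (ℤP.*-identityʳ (f v)) ⟩
    f v * + 1          ≡⟨ cong (f v *_) (sym a[v∸v]≡1) ⟩
    f v * a (v ∸ v)    ≡⟨ ∙-cancelˡ (lower f v) _ _ leading ⟩
    g v * a (v ∸ v)    ≡⟨ cong (g v *_) a[v∸v]≡1 ⟩
    g v * + 1          ≡⟨ ℤP.*-identityʳ (g v) ⟩
    g v                ∎
    where
    open ≡-Reasoning
    a[v∸v]≡1 : a (v ∸ v) ≡ + 1
    a[v∸v]≡1 = trans (cong a (ℕP.n∸n≡0 v)) a₀≡1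
    same-lower : lower f v ≡ lower g v
    same-lower = sum-cong v (λ u u<v → cong (_* a (v ∸ u)) (below u<v (ℕP.≤-trans (ℕP.<⇒≤ u<v) v≤M)))
    leading : lower f v + f v * a (v ∸ v) ≡ lower f v + g v * a (v ∸ v)
    leading = begin
      (f ⊛ a) v                  ≡⟨ ⊛-comm f a v ⟩
      (a ⊛ f) v                  ≡⟨ eq v v≤M ⟩
      (a ⊛ g) v                  ≡⟨ ⊛-comm a g v ⟩
      lower g v + g v * a (v ∸ v) ≡⟨ cong (_+ g v * a (v ∸ v)) (sym same-lower) ⟩
      lower f v + g v * a (v ∸ v) ∎

-- Overpartitions into odd parts

multiple : ℕ → (ℕ → ℕ) → ℕ → ℕ → ℕ
multiple s g w i = if does (suc i ℕ.* s ≤? w) then g (w ∸ suc i ℕ.* s) else 0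

multiplesSum : ℕ → (ℕ → ℕ) → Series
multiplesSum s g w = sumℤ w (λ i → + multiple s g w i)

opBounded-suc : ∀ j w →
  + opBounded (suc j) w ≡ + opBounded j w + + 2 * multiplesSum (2 ℕ.* j ℕ.+ 1) (opBounded j) w
opBounded-suc j w = cong (λ x → + opBounded j w + x)
  (trans (ℤP.pos-* 2 (sumℕ w (multiple s (opBounded j) w))) (cong (+ 2 *_) (sumℕ-sumℤ w (multiple s (opBounded j) w))))
  where
  s = 2 ℕ.* j ℕ.+ 1

multiple-beyond : ∀ s g w i → w < suc i ℕ.* s → multiple s g w i ≡ 0
multiple-beyond s g w i w<[1+i]s = if-no (suc i ℕ.* s ≤? w) (ℕP.<⇒≱ w<[1+i]s)

multiple-zero : ∀ s g v → multiple s g (s ℕ.+ v) 0 ≡ g v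
multiple-zero s g v rewrite ℕP.+-identityʳ s = trans (if-yes (s ≤? s ℕ.+ v) (ℕP.m≤m+n s v)) (cong g (ℕP.m+n∸m≡n s v))

multiple-suc : ∀ s g v i → multiple s g (s ℕ.+ v) (suc i) ≡ multiple s g v i
multiple-suc s g v i with suc i ℕ.* s ≤? v
... | yes [1+i]s≤v = begin
  multiple s g (s ℕ.+ v) (suc i)  ≡⟨ if-yes (s ℕ.+ suc i ℕ.* s ≤? s ℕ.+ v) (ℕP.+-monoʳ-≤ s [1+i]s≤v) ⟩
  g (s ℕ.+ v ∸ (s ℕ.+ suc i ℕ.* s)) ≡⟨ cong g (ℕP.[m+n]∸[m+o]≡n∸o s v (suc i ℕ.* s)) ⟩
  g (v ∸ suc i ℕ.* s)              ≡⟨ sym (if-yes (suc i ℕ.* s ≤? v) [1+i]s≤v) ⟩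
  multiple s g v i                 ∎
  where open ≡-Reasoning
... | no [1+i]s≰v = trans (if-no (s ℕ.+ suc i ℕ.* s ≤? s ℕ.+ v) ([1+i]s≰v ∘ ℕP.+-cancelˡ-≤ s _ _))
                           (sym (if-no (suc i ℕ.* s ≤? v) [1+i]s≰v))

multiplesSum-small : ∀ s g w → w < s → multiplesSum s g w ≡ + 0
multiplesSum-small s g w w<s =
  sum-zero w (λ i _ → cong +_ (multiple-beyond s g w i (ℕP.<-≤-trans w<s (ℕP.m≤n*m s (suc i)))))

multiplesSum-step : ∀ s g v → multiplesSum (suc s) g (suc s ℕ.+ v) ≡ + g v + multiplesSum (suc s) g v
multiplesSum-step s g v = begin
  multiplesSum (suc s) g (suc s ℕ.+ v)
    ≡⟨ sum-head (s ℕ.+ v) _ ⟩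
  + multiple (suc s) g (suc s ℕ.+ v) 0 + sumℤ (s ℕ.+ v) (λ i → + multiple (suc s) g (suc s ℕ.+ v) (suc i))
    ≡⟨ cong₂ _+_ (cong +_ (multiple-zero (suc s) g v)) (sum-ext (s ℕ.+ v) (λ i → cong +_ (multiple-suc (suc s) g v i))) ⟩
  + g v + sumℤ (s ℕ.+ v) (λ i → + multiple (suc s) g v i)
    ≡⟨ cong (λ m → + g v + sumℤ m (λ i → + multiple (suc s) g v i)) (ℕP.+-comm s v) ⟩
  + g v + sumℤ (v ℕ.+ s) (λ i → + multiple (suc s) g v i)
    ≡⟨ cong (λ x → + g v + x) (sum-split v s _) ⟩
  + g v + (multiplesSum (suc s) g v + sumℤ s (λ k → + multiple (suc s) g v (v ℕ.+ k)))
    ≡⟨ cong (λ x → + g v + (multiplesSum (suc s) g v + x))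
            (sum-zero s (λ k _ → cong +_ (multiple-beyond (suc s) g v (v ℕ.+ k) (beyond k)))) ⟩
  + g v + (multiplesSum (suc s) g v + + 0)
    ≡⟨ cong (λ x → + g v + x) (ℤP.+-identityʳ (multiplesSum (suc s) g v)) ⟩
  + g v + multiplesSum (suc s) g v ∎
  where
  open ≡-Reasoning
  beyond : ∀ k → v < suc (v ℕ.+ k) ℕ.* suc s
  beyond k = ℕP.<-≤-trans (s≤s (ℕP.m≤m+n v k)) (ℕP.m≤m*n (suc (v ℕ.+ k)) (suc s))

multiplesSum-shift : ∀ s g → multiplesSum (suc s) g ≗ shift (suc s) (λ v → + g v + multiplesSum (suc s) g v)
multiplesSum-shift s g w with suc s ≤? w
... | yes s<w = begin
  multiplesSum (suc s) g w                                 ≡⟨ cong (multiplesSum (suc s) g) (sym (ℕP.m+[n∸m]≡n s<w)) ⟩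
  multiplesSum (suc s) g (suc s ℕ.+ (w ∸ suc s))           ≡⟨ multiplesSum-step s g (w ∸ suc s) ⟩
  + g (w ∸ suc s) + multiplesSum (suc s) g (w ∸ suc s)     ≡⟨ sym (shift-≤ (λ v → + g v + multiplesSum (suc s) g v) s<w) ⟩
  shift (suc s) (λ v → + g v + multiplesSum (suc s) g v) w ∎
  where open ≡-Reasoning
... | no s≮w = trans (multiplesSum-small (suc s) g w (ℕP.≰⇒> s≮w)) (sym (shift-≰ (λ v → + g v + multiplesSum (suc s) g v) s≮w))

opSeries : ℕ → Series
opSeries j w = + opBounded j w

opSeries-zero : opSeries 0 ≗ one
opSeries-zero zero    = refl
opSeries-zero (suc w) = refl

-- With s = 2j+1, opBounded (j+1) has generating function P + 2M where M = q^s (P + M)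
-- (multiplesSum-shift), so that (1 − q^s) (P + 2M) = (1 + q^s) P.
opSeries-recurrence : ∀ j →
  binomial (- + 1) (1 ℕ.+ j ℕ.* 2) ⊛ opSeries (suc j) ≗ binomial (+ 1) (1 ℕ.+ j ℕ.* 2) ⊛ opSeries j
opSeries-recurrence j w = begin
  (binomial (- + 1) s ⊛ opSeries (suc j)) w
    ≡⟨ binomial-⊛ (- + 1) s (opSeries (suc j)) w ⟩
  opSeries (suc j) w + - + 1 * shift s (opSeries (suc j)) w
    ≡⟨ cong₂ (λ x y → x + - + 1 * y) (split w) (trans (shift-cong s split w) shift-split) ⟩
  P w + + 2 * M w + - + 1 * (shift s P w + + 2 * shift s M w)
    ≡⟨ cong (λ x → P w + + 2 * x + - + 1 * (shift s P w + + 2 * shift s M w))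
            (trans (multiplesSum-shift (j ℕ.* 2) (opBounded j) w) (shift-+ s P M w)) ⟩
  P w + + 2 * (shift s P w + shift s M w) + - + 1 * (shift s P w + + 2 * shift s M w)
    ≡⟨ collapse (P w) (shift s P w) (shift s M w) ⟩
  P w + + 1 * shift s P w
    ≡⟨ sym (binomial-⊛ (+ 1) s P w) ⟩
  (binomial (+ 1) s ⊛ P) w ∎
  where
  open ≡-Reasoning
  s = 1 ℕ.+ j ℕ.* 2
  P = opSeries j
  M = multiplesSum s (opBounded j)
  split : opSeries (suc j) ≗ λ v → P v + + 2 * M v
  split v = trans (opBounded-suc j v)
    (cong (λ t → P v + + 2 * multiplesSum t (opBounded j) v) (trans (ℕP.+-comm (2 ℕ.* j) 1) (cong suc (ℕP.*-comm 2 j))))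
  shift-split : shift s (λ v → P v + + 2 * M v) w ≡ shift s P w + + 2 * shift s M w
  shift-split = trans (shift-+ s P (λ v → + 2 * M v) w) (cong (λ x → shift s P w + x) (shift-*ˡ s (+ 2) M w))
  collapse : ∀ p a b → p + + 2 * (a + b) + - + 1 * (a + + 2 * b) ≡ p + + 1 * a
  collapse = solve-∀

opSeries-⊛-oddProduct : ∀ j → opSeries j ⊛ oddProduct (- + 1) j ≗ oddProduct (+ 1) j
opSeries-⊛-oddProduct zero    w = trans (⊛-congˡ one opSeries-zero w) (⊛-identityˡ one w)
opSeries-⊛-oddProduct (suc j) w = begin
  (P′ ⊛ (B₋ ⊛ E₋)) w ≡⟨ sym (⊛-assoc P′ B₋ E₋ w) ⟩
  (P′ ⊛ B₋ ⊛ E₋) w   ≡⟨ ⊛-congˡ E₋ (⊛-comm P′ B₋) w ⟩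
  (B₋ ⊛ P′ ⊛ E₋) w   ≡⟨ ⊛-congˡ E₋ (opSeries-recurrence j) w ⟩
  (B₊ ⊛ P ⊛ E₋) w    ≡⟨ ⊛-assoc B₊ P E₋ w ⟩
  (B₊ ⊛ (P ⊛ E₋)) w  ≡⟨ ⊛-congʳ B₊ (opSeries-⊛-oddProduct j) w ⟩
  (B₊ ⊛ E₊) w        ∎
  where
  open ≡-Reasoning
  P = opSeries j
  P′ = opSeries (suc j)
  B₋ = binomial (- + 1) (1 ℕ.+ j ℕ.* 2)
  B₊ = binomial (+ 1) (1 ℕ.+ j ℕ.* 2)
  E₋ = oddProduct (- + 1) j
  E₊ = oddProduct (+ 1) j

opBounded-suc-small : ∀ j w → w ℕ.≤ j → opBounded (suc j) w ≡ opBounded j w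
opBounded-suc-small j w w≤j = ℤP.+-injective (begin
  + opBounded (suc j) w                           ≡⟨ opBounded-suc j w ⟩
  + opBounded j w + + 2 * multiplesSum s (opBounded j) w ≡⟨ cong (λ x → + opBounded j w + + 2 * x) no-multiples ⟩
  + opBounded j w + + 0                           ≡⟨ ℤP.+-identityʳ _ ⟩
  + opBounded j w                                 ∎)
  where
  open ≡-Reasoning
  s = 2 ℕ.* j ℕ.+ 1
  j<s : j < s
  j<s = ℕP.<-≤-trans (s≤s (ℕP.m≤m+n j (j ℕ.+ 0))) (ℕP.≤-reflexive (ℕP.+-comm 1 (2 ℕ.* j)))
  no-multiples : multiplesSum s (opBounded j) w ≡ + 0
  no-multiples = sum-zero w (λ i _ → cong +_ (multiple-beyond s (opBounded j) w i
    (ℕP.≤-<-trans w≤j (ℕP.<-≤-trans j<s (ℕP.m≤n*m s (suc i))))))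

opBounded-stable : ∀ {J x} → x ℕ.≤ J → opBounded J x ≡ pbarO x
opBounded-stable {J} {x} x≤J = trans (cong (λ y → opBounded y x) (sym (ℕP.m∸n+n≡m x≤J))) (stable (J ∸ x))
  where
  stable : ∀ d → opBounded (d ℕ.+ x) x ≡ pbarO x
  stable zero    = refl
  stable (suc d) = trans (opBounded-suc-small (d ℕ.+ x) x (ℕP.m≤n+m x d)) (stable d)

-- Triangular numbers and theta series

triangular : ℕ → ℕ
triangular zero    = 0
triangular (suc k) = triangular k ℕ.+ suc k

-- zigzag n is the summation index k of the paper: triangular k = n(2n+1) and ⌈k/2⌉ = ∣n∣.
zigzag : ℤ → ℕ
zigzag (+ k)    = k ℕ.* 2
zigzag -[1+ k ] = suc (k ℕ.* 2)

triangular-even : ∀ j → + triangular (j ℕ.* 2) ≡ + j * (+ 2 * + j + + 1)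
triangular-even zero    = refl
triangular-even (suc j) = begin
  + triangular (j ℕ.* 2) + + suc (j ℕ.* 2) + + suc (suc (j ℕ.* 2))
    ≡⟨ cong₂ (λ t d → t + (+ 1 + d) + (+ 2 + d)) (triangular-even j) (ℤP.pos-* j 2) ⟩
  + j * (+ 2 * + j + + 1) + (+ 1 + + j * + 2) + (+ 2 + + j * + 2)
    ≡⟨ expand (+ j) ⟩
  (+ 1 + + j) * (+ 2 * (+ 1 + + j) + + 1) ∎
  where
  open ≡-Reasoning
  expand : ∀ J → J * (+ 2 * J + + 1) + (+ 1 + J * + 2) + (+ 2 + J * + 2) ≡ (+ 1 + J) * (+ 2 * (+ 1 + J) + + 1)
  expand = solve-∀

triangular-zigzag : ∀ n → + triangular (zigzag n) ≡ n * (+ 2 * n + + 1)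
triangular-zigzag (+ j)    = triangular-even j
triangular-zigzag -[1+ j ] = begin
  + triangular (j ℕ.* 2) + + suc (j ℕ.* 2)
    ≡⟨ cong₂ (λ t d → t + (+ 1 + d)) (triangular-even j) (ℤP.pos-* j 2) ⟩
  + j * (+ 2 * + j + + 1) + (+ 1 + + j * + 2)
    ≡⟨ expand (+ j) ⟩
  - (+ 1 + + j) * (+ 2 * - (+ 1 + + j) + + 1) ∎
  where
  open ≡-Reasoning
  expand : ∀ J → J * (+ 2 * J + + 1) + (+ 1 + J * + 2) ≡ - (+ 1 + J) * (+ 2 * - (+ 1 + J) + + 1)
  expand = solve-∀

k≤triangular : ∀ k → k ℕ.≤ triangular k
k≤triangular zero    = z≤n
k≤triangular (suc k) = ℕP.m≤n+m (suc k) (triangular k)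

triangular-mono-< : ∀ {x y} → x < y → triangular x < triangular y
triangular-mono-< {x} {suc y} (s≤s x≤y) with ℕP.m≤n⇒m<n∨m≡n x≤y
... | inj₁ x<y  = ℕP.<-trans (triangular-mono-< x<y) (ℕP.m<m+n (triangular y) (s≤s z≤n))
... | inj₂ refl = ℕP.m<m+n (triangular x) (s≤s z≤n)

triangular-injective : ∀ {x y} → triangular x ≡ triangular y → x ≡ y
triangular-injective {x} {y} eq with ℕP.<-cmp x y
... | tri< x<y _ _ = ⊥-elim (ℕP.<⇒≢ (triangular-mono-< x<y) eq)
... | tri≈ _ x≡y _ = x≡y
... | tri> _ _ y<x = ⊥-elim (ℕP.<⇒≢ (triangular-mono-< y<x) (sym eq))

mirror : ℤ → ℤ
mirror (+ j)    = -[1+ j ]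
mirror -[1+ j ] = + suc j

unzigzag : ℕ → ℤ
unzigzag zero    = + 0
unzigzag (suc k) = mirror (unzigzag k)

zigzag-mirror : ∀ n → zigzag (mirror n) ≡ suc (zigzag n)
zigzag-mirror (+ j)    = refl
zigzag-mirror -[1+ j ] = refl

unzigzag-even : ∀ j → unzigzag (j ℕ.* 2) ≡ + j
unzigzag-even zero    = refl
unzigzag-even (suc j) = cong (mirror ∘ mirror) (unzigzag-even j)

zigzag-unzigzag : ∀ k → zigzag (unzigzag k) ≡ k
zigzag-unzigzag zero    = refl
zigzag-unzigzag (suc k) = trans (zigzag-mirror (unzigzag k)) (cong suc (zigzag-unzigzag k))

unzigzag-zigzag : ∀ n → unzigzag (zigzag n) ≡ n
unzigzag-zigzag (+ j)    = unzigzag-even j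
unzigzag-zigzag -[1+ j ] = cong mirror (unzigzag-even j)

zigzag-injective : ∀ {x y} → zigzag x ≡ zigzag y → x ≡ y
zigzag-injective {x} {y} eq = trans (sym (unzigzag-zigzag x)) (trans (cong unzigzag eq) (unzigzag-zigzag y))

∣n∣≤triangular-zigzag : ∀ n → ℤ.∣ n ∣ ℕ.≤ triangular (zigzag n)
∣n∣≤triangular-zigzag n = ℕP.≤-trans (∣n∣≤zigzag n) (k≤triangular (zigzag n))
  where
  ∣n∣≤zigzag : ∀ n → ℤ.∣ n ∣ ℕ.≤ zigzag n
  ∣n∣≤zigzag (+ k)    = ℕP.m≤m*n k 2
  ∣n∣≤zigzag -[1+ k ] = s≤s (ℕP.m≤m*n k 2)

hits : ℕ → ℤ → ℤ
hits v n = 𝟙 (triangular (zigzag n) ℕ.≟ v)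

hits-vanishesBeyond : ∀ v → VanishesBeyond (hits v) v
hits-vanishesBeyond v =
  (λ j → if-no (_ ℕ.≟ v) (beyond (+ (suc v ℕ.+ j)) (s≤s (ℕP.m≤m+n v j)))) ,
  (λ j → if-no (_ ℕ.≟ v) (beyond (- + (suc v ℕ.+ j)) (s≤s (ℕP.m≤m+n v j))))
  where
  beyond : ∀ n → v < ℤ.∣ n ∣ → triangular (zigzag n) ≢ v
  beyond n v<∣n∣ eq = ℕP.<⇒≱ v<∣n∣ (subst (ℤ.∣ n ∣ ℕ.≤_) eq (∣n∣≤triangular-zigzag n))

-- theta χ = Σₙ χ(n) q^{n(2n+1)}.
theta : (ℤ → ℤ) → Series
theta χ v = centredSum v (λ n → χ n * hits v n)

theta-hit : ∀ χ n₀ → theta χ (triangular (zigzag n₀)) ≡ χ n₀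
theta-hit χ n₀ = begin
  theta χ v                   ≡⟨ centredSum-single v n₀ (∣n∣≤triangular-zigzag n₀) miss ⟩
  χ n₀ * hits v n₀            ≡⟨ cong (χ n₀ *_) (if-yes (triangular (zigzag n₀) ℕ.≟ v) refl) ⟩
  χ n₀ * + 1                  ≡⟨ ℤP.*-identityʳ (χ n₀) ⟩
  χ n₀                        ∎
  where
  open ≡-Reasoning
  v = triangular (zigzag n₀)
  miss : ∀ n → n ≢ n₀ → χ n * hits v n ≡ + 0
  miss n n≢n₀ = trans (cong (χ n *_) (if-no (_ ℕ.≟ v) (n≢n₀ ∘ zigzag-injective ∘ triangular-injective))) (ℤP.*-zeroʳ (χ n))

theta-miss : ∀ χ v → (∀ n → triangular (zigzag n) ≢ v) → theta χ v ≡ + 0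
theta-miss χ v miss = centredSum-zero v (λ n → trans (cong (χ n *_) (if-no (_ ℕ.≟ v) (miss n))) (ℤP.*-zeroʳ (χ n)))

-- A finite Jacobi triple product

isZero : ℤ → ℤ
isZero (+ zero) = + 1
isZero _        = + 0

-- jtp a b n w is the coefficient of zⁿ q^w in ∏_{i<a} (1 + z q^{4i+3}) · ∏_{i<b} (1 + z⁻¹ q^{4i+1}).
-- The exponents are written 3 + a * 4 and 1 + b * 4 so that w - + e reduces on negative w.
jtp : ℕ → ℕ → ℤ → ℤ → ℤ
jtp a       (suc b) n w        = jtp a b n w + jtp a b (n + + 1) (w - + (1 ℕ.+ b ℕ.* 4))
jtp zero    zero    n (+ zero) = isZero n
jtp zero    zero    n _        = + 0
jtp (suc a) zero    n w        = jtp a zero n w + jtp a zero (n - + 1) (w - + (3 ℕ.+ a ℕ.* 4))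

jtp-sucˡ : ∀ a b n w → jtp (suc a) b n w ≡ jtp a b n w + jtp a b (n - + 1) (w - + (3 ℕ.+ a ℕ.* 4))
jtp-sucˡ a zero    n w = refl
jtp-sucˡ a (suc b) n w = begin
  jtp (suc a) b n w + jtp (suc a) b (n + + 1) (w - B)
    ≡⟨ cong₂ _+_ (jtp-sucˡ a b n w) (jtp-sucˡ a b (n + + 1) (w - B)) ⟩
  jtp a b n w + jtp a b (n - + 1) (w - A) + (jtp a b (n + + 1) (w - B) + jtp a b (n + + 1 - + 1) (w - B - A))
    ≡⟨ cong (λ x → jtp a b n w + jtp a b (n - + 1) (w - A) + (jtp a b (n + + 1) (w - B) + x))
            (cong₂ (jtp a b) (reorder₁ n) (reorder₂ w A B)) ⟩
  jtp a b n w + jtp a b (n - + 1) (w - A) + (jtp a b (n + + 1) (w - B) + jtp a b (n - + 1 + + 1) (w - A - B))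
    ≡⟨ interchange (jtp a b n w) (jtp a b (n - + 1) (w - A)) (jtp a b (n + + 1) (w - B)) _ ⟩
  jtp a b n w + jtp a b (n + + 1) (w - B) + (jtp a b (n - + 1) (w - A) + jtp a b (n - + 1 + + 1) (w - A - B)) ∎
  where
  open ≡-Reasoning
  A = + (3 ℕ.+ a ℕ.* 4)
  B = + (1 ℕ.+ b ℕ.* 4)
  reorder₁ : ∀ n → n + + 1 - + 1 ≡ n - + 1 + + 1
  reorder₁ = solve-∀
  reorder₂ : ∀ w A B → w - B - A ≡ w - A - B
  reorder₂ = solve-∀

jtp-negative-degree : ∀ a b n k → jtp a b n -[1+ k ] ≡ + 0
jtp-negative-degree a       (suc b) n k =
  cong₂ _+_ (jtp-negative-degree a b n k) (jtp-negative-degree a b (n + + 1) (suc (k ℕ.+ b ℕ.* 4)))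
jtp-negative-degree zero    zero    n k = refl
jtp-negative-degree (suc a) zero    n k =
  cong₂ _+_ (jtp-negative-degree a zero n k) (jtp-negative-degree a zero (n - + 1) (suc (k ℕ.+ suc (suc (a ℕ.* 4)))))

jtp-origin : ∀ a b → jtp a b (+ 0) (+ 0) ≡ + 1
jtp-origin a       (suc b) = cong₂ _+_ (jtp-origin a b) (jtp-negative-degree a b (+ 1) (b ℕ.* 4))
jtp-origin zero    zero    = refl
jtp-origin (suc a) zero    = cong₂ _+_ (jtp-origin a zero) (jtp-negative-degree a zero -[1+ 0 ] (2 ℕ.+ a ℕ.* 4))

jtp-above : ∀ a b k w → jtp a b (w + + suc k) w ≡ + 0
jtp-above a (suc b) k w = cong₂ _+_ (jtp-above a b k w)
  (trans (cong (λ n → jtp a b n (w - + (1 ℕ.+ b ℕ.* 4))) (reindex w (+ k) (+ (b ℕ.* 4))))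
         (jtp-above a b (k ℕ.+ suc (suc (b ℕ.* 4))) (w - + (1 ℕ.+ b ℕ.* 4))))
  where
  reindex : ∀ w K P → w + (+ 1 + K) + + 1 ≡ w - (+ 1 + P) + (+ 1 + (K + (+ 1 + (+ 1 + P))))
  reindex = solve-∀
jtp-above zero    zero k (+ zero)  = refl
jtp-above zero    zero k (+ suc _) = refl
jtp-above zero    zero k -[1+ _ ]  = refl
jtp-above (suc a) zero k w = cong₂ _+_ (jtp-above a zero k w)
  (trans (cong (λ n → jtp a zero n (w - + (3 ℕ.+ a ℕ.* 4))) (reindex w (+ k) (+ (2 ℕ.+ a ℕ.* 4))))
         (jtp-above a zero (k ℕ.+ (2 ℕ.+ a ℕ.* 4)) (w - + (3 ℕ.+ a ℕ.* 4))))
  where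
  reindex : ∀ w K P → w + (+ 1 + K) - + 1 ≡ w - (+ 1 + P) + (+ 1 + (K + P))
  reindex = solve-∀

jtp-below : ∀ a b k w → jtp a b (- (w + + suc k)) w ≡ + 0
jtp-below a (suc b) k w = cong₂ _+_ (jtp-below a b k w)
  (trans (cong (λ n → jtp a b n (w - + (1 ℕ.+ b ℕ.* 4))) (reindex w (+ k) (+ (b ℕ.* 4))))
         (jtp-below a b (k ℕ.+ b ℕ.* 4) (w - + (1 ℕ.+ b ℕ.* 4))))
  where
  reindex : ∀ w K P → - (w + (+ 1 + K)) + + 1 ≡ - (w - (+ 1 + P) + (+ 1 + (K + P)))
  reindex = solve-∀
jtp-below zero    zero k (+ zero)  = refl
jtp-below zero    zero k (+ suc _) = refl
jtp-below zero    zero k -[1+ _ ]  = refl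
jtp-below (suc a) zero k w = cong₂ _+_ (jtp-below a zero k w)
  (trans (cong (λ n → jtp a zero n (w - + (3 ℕ.+ a ℕ.* 4))) (reindex w (+ k) (+ (2 ℕ.+ a ℕ.* 4))))
         (jtp-below a zero (k ℕ.+ suc (suc (2 ℕ.+ a ℕ.* 4))) (w - + (3 ℕ.+ a ℕ.* 4))))
  where
  reindex : ∀ w K P → - (w + (+ 1 + K)) - + 1 ≡ - (w - (+ 1 + P) + (+ 1 + (K + (+ 1 + (+ 1 + P)))))
  reindex = solve-∀

jtp-vanishesBeyond : ∀ a b w → VanishesBeyond (λ n → jtp a b n (+ w)) w
jtp-vanishesBeyond a b w =
  (λ j → trans (cong (λ x → jtp a b (+ x) (+ w)) (sym (ℕP.+-suc w j))) (jtp-above a b j (+ w))) ,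
  (λ j → trans (cong (λ x → jtp a b (- + x) (+ w)) (sym (ℕP.+-suc w j))) (jtp-below a b j (+ w)))

jtp-sucˡ-low : ∀ a b n {w} → w < 3 ℕ.+ a ℕ.* 4 → jtp (suc a) b n (+ w) ≡ jtp a b n (+ w)
jtp-sucˡ-low a b n {w} w<A = begin
  jtp (suc a) b n (+ w)                                              ≡⟨ jtp-sucˡ a b n (+ w) ⟩
  jtp a b n (+ w) + jtp a b (n - + 1) (+ w - + (3 ℕ.+ a ℕ.* 4))
    ≡⟨ cong (λ x → jtp a b n (+ w) + jtp a b (n - + 1) x) (+m-+n-negative w<A) ⟩
  jtp a b n (+ w) + jtp a b (n - + 1) -[1+ (3 ℕ.+ a ℕ.* 4 ∸ suc w) ]
    ≡⟨ cong (λ x → jtp a b n (+ w) + x) (jtp-negative-degree a b (n - + 1) _) ⟩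
  jtp a b n (+ w) + + 0                                              ≡⟨ ℤP.+-identityʳ _ ⟩
  jtp a b n (+ w)                                                    ∎
  where open ≡-Reasoning

jtp-sucʳ-low : ∀ a b n {w} → w < 1 ℕ.+ b ℕ.* 4 → jtp a (suc b) n (+ w) ≡ jtp a b n (+ w)
jtp-sucʳ-low a b n {w} w<B = begin
  jtp a b n (+ w) + jtp a b (n + + 1) (+ w - + (1 ℕ.+ b ℕ.* 4))
    ≡⟨ cong (λ x → jtp a b n (+ w) + jtp a b (n + + 1) x) (+m-+n-negative w<B) ⟩
  jtp a b n (+ w) + jtp a b (n + + 1) -[1+ (1 ℕ.+ b ℕ.* 4 ∸ suc w) ]
    ≡⟨ cong (λ x → jtp a b n (+ w) + x) (jtp-negative-degree a b (n + + 1) _) ⟩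
  jtp a b n (+ w) + + 0                                              ≡⟨ ℤP.+-identityʳ _ ⟩
  jtp a b n (+ w)                                                    ∎
  where open ≡-Reasoning

jtp₀₀-≢0 : ∀ n v → isZero n ≡ + 0 → jtp 0 0 n v ≡ + 0
jtp₀₀-≢0 n (+ zero)  n≢0 = n≢0
jtp₀₀-≢0 n (+ suc _) _   = refl
jtp₀₀-≢0 n -[1+ _ ]  _   = refl

jtp₀₀-shift : ∀ n v → jtp 0 0 n (v + + 4 * n) ≡ jtp 0 0 n v
jtp₀₀-shift (+ zero)  v = cong (jtp 0 0 (+ 0)) (ℤP.+-identityʳ v)
jtp₀₀-shift (+ suc k) v = trans (jtp₀₀-≢0 (+ suc k) (v + + 4 * + suc k) refl) (sym (jtp₀₀-≢0 (+ suc k) v refl))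
jtp₀₀-shift -[1+ k ]  v = trans (jtp₀₀-≢0 -[1+ k ] (v + + 4 * -[1+ k ]) refl) (sym (jtp₀₀-≢0 -[1+ k ] v refl))

-- For the product G a b encoded by jtp a b: G (a + 1) b (z q⁻⁴) = z q⁻¹ · G a (b + 1) z.
jtp-functional : ∀ a b n w → jtp a (suc b) (n - + 1) w ≡ jtp (suc a) b n (w + (+ 4 * n - + 1))
jtp-functional zero zero n w = begin
  jtp 0 0 (n - + 1) w + jtp 0 0 (n - + 1 + + 1) (w - + 1)
    ≡⟨ cong₂ _+_ (sym (jtp₀₀-shift (n - + 1) w)) (cong (λ m → jtp 0 0 m (w - + 1)) (cancel n)) ⟩
  jtp 0 0 (n - + 1) (w + + 4 * (n - + 1)) + jtp 0 0 n (w - + 1)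
    ≡⟨ cong₂ _+_ (cong (jtp 0 0 (n - + 1)) (shifted₁ n w))
                 (trans (sym (jtp₀₀-shift n (w - + 1))) (cong (jtp 0 0 n) (shifted₂ n w))) ⟩
  jtp 0 0 (n - + 1) (w′ - + 3) + jtp 0 0 n w′
    ≡⟨ ℤP.+-comm (jtp 0 0 (n - + 1) (w′ - + 3)) (jtp 0 0 n w′) ⟩
  jtp 0 0 n w′ + jtp 0 0 (n - + 1) (w′ - + 3) ∎
  where
  open ≡-Reasoning
  w′ = w + (+ 4 * n - + 1)
  cancel : ∀ n → n - + 1 + + 1 ≡ n
  cancel = solve-∀
  shifted₁ : ∀ n w → w + + 4 * (n - + 1) ≡ w + (+ 4 * n - + 1) - + 3
  shifted₁ = solve-∀
  shifted₂ : ∀ n w → w - + 1 + + 4 * n ≡ w + (+ 4 * n - + 1)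
  shifted₂ = solve-∀
jtp-functional zero (suc b) n w = begin
  jtp 0 (suc b) (n - + 1) w + jtp 0 (suc b) (n - + 1 + + 1) (w - + (1 ℕ.+ suc b ℕ.* 4))
    ≡⟨ cong₂ _+_ (jtp-functional zero b n w) (cong (λ m → jtp 0 (suc b) m (w - + (1 ℕ.+ suc b ℕ.* 4))) (reorder n)) ⟩
  jtp 1 b n w′ + jtp 0 (suc b) (n + + 1 - + 1) (w - + (1 ℕ.+ suc b ℕ.* 4))
    ≡⟨ cong (λ x → jtp 1 b n w′ + x) (jtp-functional zero b (n + + 1) _) ⟩
  jtp 1 b n w′ + jtp 1 b (n + + 1) (w - + (1 ℕ.+ suc b ℕ.* 4) + (+ 4 * (n + + 1) - + 1))
    ≡⟨ cong (λ v → jtp 1 b n w′ + jtp 1 b (n + + 1) v) (shifted w n (+ (b ℕ.* 4))) ⟩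
  jtp 1 b n w′ + jtp 1 b (n + + 1) (w′ - + (1 ℕ.+ b ℕ.* 4)) ∎
  where
  open ≡-Reasoning
  w′ = w + (+ 4 * n - + 1)
  reorder : ∀ n → n - + 1 + + 1 ≡ n + + 1 - + 1
  reorder = solve-∀
  shifted : ∀ w n P → w - (+ 1 + (+ 4 + P)) + (+ 4 * (n + + 1) - + 1) ≡ w + (+ 4 * n - + 1) - (+ 1 + P)
  shifted = solve-∀
jtp-functional (suc a) b n w = begin
  jtp (suc a) (suc b) (n - + 1) w
    ≡⟨ jtp-sucˡ a (suc b) (n - + 1) w ⟩
  jtp a (suc b) (n - + 1) w + jtp a (suc b) (n - + 1 - + 1) (w - + (3 ℕ.+ a ℕ.* 4))
    ≡⟨ cong₂ _+_ (jtp-functional a b n w) (jtp-functional a b (n - + 1) _) ⟩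
  jtp (suc a) b n w′ + jtp (suc a) b (n - + 1) (w - + (3 ℕ.+ a ℕ.* 4) + (+ 4 * (n - + 1) - + 1))
    ≡⟨ cong (λ v → jtp (suc a) b n w′ + jtp (suc a) b (n - + 1) v) (shifted w n (+ (a ℕ.* 4))) ⟩
  jtp (suc a) b n w′ + jtp (suc a) b (n - + 1) (w′ - + (3 ℕ.+ suc a ℕ.* 4))
    ≡⟨ sym (jtp-sucˡ (suc a) b n w′) ⟩
  jtp (suc (suc a)) b n w′ ∎
  where
  open ≡-Reasoning
  w′ = w + (+ 4 * n - + 1)
  shifted : ∀ w n P → w - (+ 3 + P) + (+ 4 * (n - + 1) - + 1) ≡ w + (+ 4 * n - + 1) - (+ 3 + (+ 4 + P))
  shifted = solve-∀

module Diagonal (m : ℕ) where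

  C : ℤ → ℤ → ℤ
  C = jtp (suc m) (suc m)

  C₀ : Series
  C₀ w = C (+ 0) (+ w)

  C-stable : ∀ n {v} → v ℤ.≤ + m → jtp (suc (suc m)) m n v ≡ C n v
  C-stable n {+ v} (ℤ.+≤+ v≤m) =
    trans (jtp-sucˡ-low (suc m) m n (s≤s (ℕP.≤-trans v≤4m (ℕP.m≤n+m (m ℕ.* 4) 6))))
          (sym (jtp-sucʳ-low (suc m) m n (s≤s v≤4m)))
    where
    v≤4m : v ℕ.≤ m ℕ.* 4
    v≤4m = ℕP.≤-trans v≤m (ℕP.m≤m*n m 4)
  C-stable n { -[1+ k ]} _ = trans (jtp-negative-degree _ m n k) (sym (jtp-negative-degree (suc m) (suc m) n k))

  C-shift : ∀ n w → w + (+ 4 * n - + 1) ℤ.≤ + m → C (n - + 1) w ≡ C n (w + (+ 4 * n - + 1))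
  C-shift n w w′≤m = trans (jtp-functional (suc m) m n w) (C-stable n w′≤m)

  C-nonneg : ∀ k w → w ℤ.≤ + m → C (+ k) w ≡ C (+ 0) (w - + k * (+ 2 * + k + + 1))
  C-nonneg zero    w _   = cong (C (+ 0)) (sym (ℤP.+-identityʳ w))
  C-nonneg (suc k) w w≤m = begin
    C (+ suc k) w                              ≡⟨ cong (C (+ suc k)) (sym restore) ⟩
    C (+ suc k) (w₀ + (+ 4 * + suc k - + 1))   ≡⟨ sym (C-shift (+ suc k) w₀ (subst (ℤ._≤ + m) (sym restore) w≤m)) ⟩
    C (+ k) w₀                                 ≡⟨ C-nonneg k w₀ (ℤP.i≤j⇒i-k≤j (+ (3 ℕ.+ k ℕ.* 4)) w≤m) ⟩
    C (+ 0) (w₀ - + k * (+ 2 * + k + + 1))     ≡⟨ cong (C (+ 0)) exponent ⟩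
    C (+ 0) (w - + suc k * (+ 2 * + suc k + + 1)) ∎
    where
    open ≡-Reasoning
    w₀ = w - + (3 ℕ.+ k ℕ.* 4)
    3+4k : + (3 ℕ.+ k ℕ.* 4) ≡ + 3 + + k * + 4
    3+4k = cong (λ x → + 3 + x) (ℤP.pos-* k 4)
    restore : w₀ + (+ 4 * + suc k - + 1) ≡ w
    restore = trans (cong (λ x → w - x + (+ 4 * + suc k - + 1)) 3+4k) (cancel w (+ k))
      where
      cancel : ∀ w K → w - (+ 3 + K * + 4) + (+ 4 * (+ 1 + K) - + 1) ≡ w
      cancel = solve-∀
    exponent : w₀ - + k * (+ 2 * + k + + 1) ≡ w - + suc k * (+ 2 * + suc k + + 1)
    exponent = trans (cong (λ x → w - x - + k * (+ 2 * + k + + 1)) 3+4k) (step w (+ k))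
      where
      step : ∀ w K → w - (+ 3 + K * + 4) - K * (+ 2 * K + + 1) ≡ w - (+ 1 + K) * (+ 2 * (+ 1 + K) + + 1)
      step = solve-∀

  C-nonpos : ∀ k w → w ℤ.≤ + m → C (- + k) w ≡ C (+ 0) (w - - + k * (+ 2 * - + k + + 1))
  C-nonpos zero    w _   = cong (C (+ 0)) (sym (ℤP.+-identityʳ w))
  C-nonpos (suc k) w w≤m = begin
    C (- + suc k) w                                  ≡⟨ cong (λ n → C n w) (pred (+ k)) ⟩
    C (- + k - + 1) w                                ≡⟨ C-shift (- + k) w w₁≤m ⟩
    C (- + k) w₁                                     ≡⟨ C-nonpos k w₁ w₁≤m ⟩
    C (+ 0) (w₁ - - + k * (+ 2 * - + k + + 1))       ≡⟨ cong (C (+ 0)) (step w (+ k)) ⟩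
    C (+ 0) (w - - + suc k * (+ 2 * - + suc k + + 1)) ∎
    where
    open ≡-Reasoning
    w₁ = w + (+ 4 * - + k - + 1)
    pred : ∀ K → - (+ 1 + K) ≡ - K - + 1
    pred = solve-∀
    shrink : ∀ w K → w + (+ 4 * - K - + 1) ≡ w - (+ 1 + K * + 4)
    shrink = solve-∀
    w₁≤m : w₁ ℤ.≤ + m
    w₁≤m = subst (ℤ._≤ + m) (sym (trans (shrink w (+ k)) (cong (λ x → w - (+ 1 + x)) (sym (ℤP.pos-* k 4)))))
                 (ℤP.i≤j⇒i-k≤j (+ (1 ℕ.+ k ℕ.* 4)) w≤m)
    step : ∀ w K → w + (+ 4 * - K - + 1) - - K * (+ 2 * - K + + 1) ≡ w - - (+ 1 + K) * (+ 2 * - (+ 1 + K) + + 1)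
    step = solve-∀

  -- Jacobi's triple product identity in degrees ≤ m.
  C-decompose : ∀ n w → w ℤ.≤ + m → C n w ≡ C (+ 0) (w - + triangular (zigzag n))
  C-decompose (+ k)    w w≤m =
    trans (C-nonneg k w w≤m) (cong (λ t → C (+ 0) (w - t)) (sym (triangular-zigzag (+ k))))
  C-decompose -[1+ k ] w w≤m =
    trans (C-nonpos (suc k) w w≤m) (cong (λ t → C (+ 0) (w - t)) (sym (triangular-zigzag -[1+ k ])))

  C₀-miss : ∀ (χ : ℤ → ℤ) {w} i n → triangular (zigzag n) ≢ w ∸ i → C₀ i * (χ n * hits (w ∸ i) n) ≡ + 0
  C₀-miss χ {w} i n t≢w∸i = begin
    C₀ i * (χ n * hits (w ∸ i) n) ≡⟨ cong (λ x → C₀ i * (χ n * x)) (if-no (triangular (zigzag n) ℕ.≟ w ∸ i) t≢w∸i) ⟩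
    C₀ i * (χ n * + 0)            ≡⟨ cong (C₀ i *_) (ℤP.*-zeroʳ (χ n)) ⟩
    C₀ i * + 0                    ≡⟨ ℤP.*-zeroʳ (C₀ i) ⟩
    + 0                           ∎
    where open ≡-Reasoning

  C₀-hits : ∀ (χ : ℤ → ℤ) w n →
    sumℤ (suc w) (λ i → C₀ i * (χ n * hits (w ∸ i) n)) ≡ χ n * C (+ 0) (+ w - + triangular (zigzag n))
  C₀-hits χ w n with triangular (zigzag n) ℕ.≤? w
  ... | yes t≤w = begin
    sumℤ (suc w) (λ i → C₀ i * (χ n * hits (w ∸ i) n))
      ≡⟨ sum-single (suc w) (w ∸ t) (s≤s (ℕP.m∸n≤m w t)) (λ i i≤w i≢w∸t → C₀-miss χ i n (i≢w∸t ∘ solve i≤w)) ⟩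
    C₀ (w ∸ t) * (χ n * hits (w ∸ (w ∸ t)) n)
      ≡⟨ cong (λ x → C₀ (w ∸ t) * (χ n * x)) (if-yes (t ℕ.≟ w ∸ (w ∸ t)) (sym (ℕP.m∸[m∸n]≡n t≤w))) ⟩
    C₀ (w ∸ t) * (χ n * + 1)
      ≡⟨ trans (cong (C₀ (w ∸ t) *_) (ℤP.*-identityʳ (χ n))) (ℤP.*-comm (C₀ (w ∸ t)) (χ n)) ⟩
    χ n * C (+ 0) (+ (w ∸ t))
      ≡⟨ cong (λ x → χ n * C (+ 0) x) (sym (trans (ℤP.m-n≡m⊖n w t) (ℤP.⊖-≥ t≤w))) ⟩
    χ n * C (+ 0) (+ w - + t) ∎
    where
    open ≡-Reasoning
    t = triangular (zigzag n)
    solve : ∀ {i} → i < suc w → t ≡ w ∸ i → i ≡ w ∸ t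
    solve {i} i≤w t≡w∸i = trans (sym (ℕP.m∸[m∸n]≡n (ℕP.≤-pred i≤w))) (cong (w ∸_) (sym t≡w∸i))
  ... | no t≰w = begin
    sumℤ (suc w) (λ i → C₀ i * (χ n * hits (w ∸ i) n))
      ≡⟨ sum-zero (suc w) (λ i _ → C₀-miss χ i n (λ t≡w∸i → t≰w (subst (ℕ._≤ w) (sym t≡w∸i) (ℕP.m∸n≤m w i)))) ⟩
    + 0
      ≡⟨ sym (ℤP.*-zeroʳ (χ n)) ⟩
    χ n * + 0
      ≡⟨ cong (χ n *_) (sym (trans (cong (C (+ 0)) (+m-+n-negative (ℕP.≰⇒> t≰w)))
                                   (jtp-negative-degree (suc m) (suc m) (+ 0) _))) ⟩
    χ n * C (+ 0) (+ w - + triangular (zigzag n)) ∎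
    where open ≡-Reasoning

  evaluation-factorises : ∀ (χ : ℤ → ℤ) w → w ℕ.≤ m → centredSum w (λ n → χ n * C n (+ w)) ≡ (C₀ ⊛ theta χ) w
  evaluation-factorises χ w w≤m = sym (begin
    sumℤ (suc w) (λ i → C₀ i * theta χ (w ∸ i))
      ≡⟨ sum-cong (suc w) (λ i _ → cong (C₀ i *_) (sym (centredSum-enlarge {f = λ n → χ n * hits (w ∸ i) n}
           (vanishesBeyond-*ˡ χ {hits (w ∸ i)} (hits-vanishesBeyond (w ∸ i))) (ℕP.m∸n≤m w i)))) ⟩
    sumℤ (suc w) (λ i → C₀ i * centredSum w (λ n → χ n * hits (w ∸ i) n))
      ≡⟨ sum-ext (suc w) (λ i → sym (centredSum-*ˡ w (C₀ i) (λ n → χ n * hits (w ∸ i) n))) ⟩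
    sumℤ (suc w) (λ i → centredSum w (λ n → C₀ i * (χ n * hits (w ∸ i) n)))
      ≡⟨ sum-comm (suc w) (suc (w ℕ.+ w)) (λ i j → C₀ i * (χ (- + w + + j) * hits (w ∸ i) (- + w + + j))) ⟩
    centredSum w (λ n → sumℤ (suc w) (λ i → C₀ i * (χ n * hits (w ∸ i) n)))
      ≡⟨ centredSum-ext w (λ n → trans (C₀-hits χ w n) (cong (χ n *_) (sym (C-decompose n (+ w) (ℤ.+≤+ w≤m))))) ⟩
    centredSum w (λ n → χ n * C n (+ w)) ∎)
    where open ≡-Reasoning

-- Specialising the triple product

∣n+1∣-adjacent : ∀ n → ℤ.∣ n ∣ ≡ suc ℤ.∣ n + + 1 ∣ ⊎ ℤ.∣ n + + 1 ∣ ≡ suc ℤ.∣ n ∣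
∣n+1∣-adjacent (+ k)          = inj₂ (ℕP.+-comm k 1)
∣n+1∣-adjacent -[1+ zero ]    = inj₁ refl
∣n+1∣-adjacent -[1+ suc k ]   = inj₁ refl

module Specialisation (ε : ℤ) (ε*ε≡1 : ε * ε ≡ + 1) where

  χ : ℤ → ℤ
  χ n = ε ^ ℤ.∣ n ∣

  ^-adjacent : ∀ {k l} → k ≡ suc l ⊎ l ≡ suc k → ε ^ k ≡ ε * ε ^ l
  ^-adjacent (inj₁ refl)      = refl
  ^-adjacent {k} (inj₂ refl) = begin
    ε ^ k               ≡⟨ sym (ℤP.*-identityˡ (ε ^ k)) ⟩
    + 1 * ε ^ k         ≡⟨ cong (_* ε ^ k) (sym ε*ε≡1) ⟩
    ε * ε * ε ^ k       ≡⟨ ℤP.*-assoc ε ε (ε ^ k) ⟩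
    ε * (ε * ε ^ k)     ∎
    where open ≡-Reasoning

  χ-succ : ∀ n → χ n ≡ ε * χ (n + + 1)
  χ-succ n = ^-adjacent (∣n+1∣-adjacent n)

  χ-pred : ∀ n → χ n ≡ ε * χ (n - + 1)
  χ-pred n = ^-adjacent (subst (λ x → ℤ.∣ x ∣ ≡ suc ℤ.∣ n - + 1 ∣ ⊎ ℤ.∣ n - + 1 ∣ ≡ suc ℤ.∣ x ∣) (cancel n)
                                (swap (∣n+1∣-adjacent (n - + 1))))
    where
    cancel : ∀ n → n - + 1 + + 1 ≡ n
    cancel = solve-∀

  summand : ℕ → ℕ → ℕ → ℤ → ℤ
  summand a b w n = χ n * jtp a b n (+ w)

  -- The product encoded by jtp a b at z = ε; the window ∣n∣ ≤ w suffices by jtp-vanishesBeyond.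
  evaluate : ℕ → ℕ → Series
  evaluate a b w = centredSum w (summand a b w)

  evaluate-translated : ∀ a b s d → (∀ n → χ n ≡ ε * χ (n + d)) →
    (∀ f {r R} → VanishesBeyond f r → r < R → centredSum R (λ n → f (n + d)) ≡ centredSum r f) →
    ∀ w → centredSum w (λ n → χ n * jtp a b (n + d) (+ w - + suc s)) ≡ ε * shift (suc s) (evaluate a b) w
  evaluate-translated a b s d χ-step translate w with suc s ≤? w
  ... | yes s<w = begin
    centredSum w (λ n → χ n * jtp a b (n + d) (+ w - + suc s))
      ≡⟨ centredSum-ext w (λ n → cong₂ _*_ (χ-step n) (cong (jtp a b (n + d)) w-s≡v)) ⟩
    centredSum w (λ n → ε * χ (n + d) * jtp a b (n + d) (+ v))
      ≡⟨ centredSum-ext w (λ n → ℤP.*-assoc ε (χ (n + d)) (jtp a b (n + d) (+ v))) ⟩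
    centredSum w (λ n → ε * summand a b v (n + d))
      ≡⟨ centredSum-*ˡ w ε (λ n → summand a b v (n + d)) ⟩
    ε * centredSum w (λ n → summand a b v (n + d))
      ≡⟨ cong (ε *_) (translate (summand a b v) vanishes (ℕP.∸-monoʳ-< (s≤s z≤n) s<w)) ⟩
    ε * evaluate a b v
      ≡⟨ cong (ε *_) (sym (shift-≤ (evaluate a b) s<w)) ⟩
    ε * shift (suc s) (evaluate a b) w ∎
    where
    open ≡-Reasoning
    v = w ∸ suc s
    w-s≡v : + w - + suc s ≡ + v
    w-s≡v = trans (ℤP.m-n≡m⊖n w (suc s)) (ℤP.⊖-≥ s<w)
    vanishes : VanishesBeyond (summand a b v) v
    vanishes = vanishesBeyond-*ˡ χ {λ n → jtp a b n (+ v)} (jtp-vanishesBeyond a b v)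
  ... | no s≮w = begin
    centredSum w (λ n → χ n * jtp a b (n + d) (+ w - + suc s))
      ≡⟨ centredSum-zero w (λ n → trans (cong (λ x → χ n * jtp a b (n + d) x) (+m-+n-negative (ℕP.≰⇒> s≮w)))
                                (trans (cong (χ n *_) (jtp-negative-degree a b (n + d) _)) (ℤP.*-zeroʳ (χ n)))) ⟩
    + 0
      ≡⟨ sym (trans (cong (ε *_) (shift-≰ (evaluate a b) s≮w)) (ℤP.*-zeroʳ ε)) ⟩
    ε * shift (suc s) (evaluate a b) w ∎
    where open ≡-Reasoning

  evaluate-sucˡ : ∀ a b → evaluate (suc a) b ≗ binomial ε (3 ℕ.+ a ℕ.* 4) ⊛ evaluate a b
  evaluate-sucˡ a b w = begin
    evaluate (suc a) b w
      ≡⟨ centredSum-ext w split ⟩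
    centredSum w (λ n → summand a b w n + tail n)
      ≡⟨ centredSum-+ w (summand a b w) tail ⟩
    evaluate a b w + centredSum w tail
      ≡⟨ cong (λ x → evaluate a b w + x) (evaluate-translated a b (2 ℕ.+ a ℕ.* 4) (- + 1) χ-pred centredSum-translate⁻ w) ⟩
    evaluate a b w + ε * shift A (evaluate a b) w
      ≡⟨ sym (binomial-⊛ ε A (evaluate a b) w) ⟩
    (binomial ε A ⊛ evaluate a b) w ∎
    where
    open ≡-Reasoning
    A = 3 ℕ.+ a ℕ.* 4
    tail : ℤ → ℤ
    tail n = χ n * jtp a b (n - + 1) (+ w - + A)
    split : ∀ n → summand (suc a) b w n ≡ summand a b w n + tail n
    split n = trans (cong (χ n *_) (jtp-sucˡ a b n (+ w))) (ℤP.*-distribˡ-+ (χ n) (jtp a b n (+ w)) _)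

  evaluate-sucʳ : ∀ a b → evaluate a (suc b) ≗ binomial ε (1 ℕ.+ b ℕ.* 4) ⊛ evaluate a b
  evaluate-sucʳ a b w = begin
    evaluate a (suc b) w
      ≡⟨ centredSum-ext w (λ n → ℤP.*-distribˡ-+ (χ n) (jtp a b n (+ w)) (jtp a b (n + + 1) (+ w - + B))) ⟩
    centredSum w (λ n → summand a b w n + tail n)
      ≡⟨ centredSum-+ w (summand a b w) tail ⟩
    evaluate a b w + centredSum w tail
      ≡⟨ cong (λ x → evaluate a b w + x) (evaluate-translated a b (b ℕ.* 4) (+ 1) χ-succ centredSum-translate⁺ w) ⟩
    evaluate a b w + ε * shift B (evaluate a b) w
      ≡⟨ sym (binomial-⊛ ε B (evaluate a b) w) ⟩
    (binomial ε B ⊛ evaluate a b) w ∎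
    where
    open ≡-Reasoning
    B = 1 ℕ.+ b ℕ.* 4
    tail : ℤ → ℤ
    tail n = χ n * jtp a b (n + + 1) (+ w - + B)

  evaluate-zero : evaluate 0 0 ≗ one
  evaluate-zero zero    = trans (window-single (- + 0) (summand 0 0 0)) (ℤP.*-identityʳ (χ (+ 0)))
  evaluate-zero (suc w) = centredSum-zero (suc w) (λ n → ℤP.*-zeroʳ (χ n))

  evaluate-diagonal : ∀ L → evaluate L L ≗ oddProduct ε (L ℕ.* 2)
  evaluate-diagonal zero    = evaluate-zero
  evaluate-diagonal (suc L) w = begin
    evaluate (suc L) (suc L) w     ≡⟨ evaluate-sucʳ (suc L) L w ⟩
    (B ⊛ evaluate (suc L) L) w     ≡⟨ ⊛-congʳ B (evaluate-sucˡ L L) w ⟩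
    (B ⊛ (A ⊛ evaluate L L)) w     ≡⟨ ⊛-congʳ B (⊛-congʳ A (evaluate-diagonal L)) w ⟩
    (B ⊛ (A ⊛ E)) w                ≡⟨ ⊛-exchange B A E w ⟩
    (A ⊛ (B ⊛ E)) w
      ≡⟨ cong (λ k → (binomial ε (3 ℕ.+ k) ⊛ (binomial ε (1 ℕ.+ k) ⊛ E)) w) (sym (ℕP.*-assoc L 2 2)) ⟩
    oddProduct ε (suc L ℕ.* 2) w   ∎
    where
    open ≡-Reasoning
    A = binomial ε (3 ℕ.+ L ℕ.* 4)
    B = binomial ε (1 ℕ.+ L ℕ.* 4)
    E = oddProduct ε (L ℕ.* 2)

  oddProduct-factorises : ∀ m i → i ℕ.≤ m → oddProduct ε (suc m ℕ.* 2) i ≡ (Diagonal.C₀ m ⊛ theta χ) i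
  oddProduct-factorises m i i≤m =
    trans (sym (evaluate-diagonal (suc m) i)) (Diagonal.evaluation-factorises m χ i i≤m)

module Alternating = Specialisation (- + 1) refl
module Constant    = Specialisation (+ 1) refl

opSeries-⊛-theta : ∀ m → (opSeries (suc m ℕ.* 2) ⊛ theta Alternating.χ) m ≡ theta Constant.χ m
opSeries-⊛-theta m =
  ⊛-cancelˡ C₀ {opSeries J ⊛ theta Alternating.χ} {theta Constant.χ} m (jtp-origin (suc m) (suc m)) agree m ℕP.≤-refl
  where
  open Diagonal m using (C₀)
  J = suc m ℕ.* 2
  agree : ∀ v → v ℕ.≤ m → (C₀ ⊛ (opSeries J ⊛ theta Alternating.χ)) v ≡ (C₀ ⊛ theta Constant.χ) v
  agree v v≤m = begin
    (C₀ ⊛ (opSeries J ⊛ theta Alternating.χ)) v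
      ≡⟨ ⊛-exchange C₀ (opSeries J) (theta Alternating.χ) v ⟩
    (opSeries J ⊛ (C₀ ⊛ theta Alternating.χ)) v
      ≡⟨ ⊛-cong-≤ v {opSeries J} {opSeries J} (λ _ _ → refl)
                  (λ i i≤v → sym (Alternating.oddProduct-factorises m i (ℕP.≤-trans i≤v v≤m))) ⟩
    (opSeries J ⊛ oddProduct (- + 1) J) v
      ≡⟨ opSeries-⊛-oddProduct J v ⟩
    oddProduct (+ 1) J v
      ≡⟨ Constant.oddProduct-factorises m v v≤m ⟩
    (C₀ ⊛ theta Constant.χ) v ∎
    where open ≡-Reasoning

triangular*2 : ∀ k → triangular k ℕ.* 2 ≡ k ℕ.* suc k
triangular*2 zero    = refl
triangular*2 (suc k) = begin
  (triangular k ℕ.+ suc k) ℕ.* 2        ≡⟨ ℕP.*-distribʳ-+ 2 (triangular k) (suc k) ⟩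
  triangular k ℕ.* 2 ℕ.+ suc k ℕ.* 2    ≡⟨ cong (ℕ._+ suc k ℕ.* 2) (triangular*2 k) ⟩
  k ℕ.* suc k ℕ.+ suc k ℕ.* 2           ≡⟨ expand k ⟩
  suc k ℕ.* suc (suc k)                 ∎
  where
  open ≡-Reasoning
  expand : ∀ k → k ℕ.* suc k ℕ.+ suc k ℕ.* 2 ≡ suc k ℕ.* suc (suc k)
  expand = NS.solve-∀

tri≡triangular : ∀ k → tri k ≡ triangular k
tri≡triangular k = trans (cong (_/ 2) (sym (triangular*2 k))) (DM.m*n/n≡m (triangular k) 2)

parity-sign : ∀ j → (if (j % 2) ≡ᵇ 0 then + 1 else - + 1) ≡ (- + 1) ^ j
parity-sign zero          = refl
parity-sign (suc zero)    = refl
parity-sign (suc (suc j)) = begin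
  (if (suc (suc j) % 2) ≡ᵇ 0 then + 1 else - + 1)
    ≡⟨ cong (λ r → if r ≡ᵇ 0 then + 1 else - + 1) (trans (cong (_% 2) (ℕP.+-comm 2 j)) (DM.[m+n]%n≡m%n j 2)) ⟩
  (if (j % 2) ≡ᵇ 0 then + 1 else - + 1)           ≡⟨ parity-sign j ⟩
  (- + 1) ^ j                                     ≡⟨ sym (square-cancel ((- + 1) ^ j)) ⟩
  (- + 1) ^ suc (suc j)                           ∎
  where
  open ≡-Reasoning
  square-cancel : ∀ x → - + 1 * (- + 1 * x) ≡ x
  square-cancel = solve-∀

signCeilHalf-zigzag : ∀ n → signCeilHalf (zigzag n) ≡ Alternating.χ n
signCeilHalf-zigzag (+ j)    =
  trans (cong (λ h → if (h % 2) ≡ᵇ 0 then + 1 else - + 1) half) (parity-sign j)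
  where
  half : suc (j ℕ.* 2) / 2 ≡ j
  half = trans (DM.+-distrib-/ 1 (j ℕ.* 2) (subst (λ r → 1 ℕ.+ r < 2) (sym (DM.m*n%n≡0 j 2)) ℕP.≤-refl))
               (DM.m*n/n≡m j 2)
signCeilHalf-zigzag -[1+ j ] =
  trans (cong (λ h → if (h % 2) ≡ᵇ 0 then + 1 else - + 1) (DM.m*n/n≡m (suc j) 2)) (parity-sign (suc j))

signedHits : ℕ → ℕ → ℤ
signedHits i k = signCeilHalf k * 𝟙 (triangular k ℕ.≟ i)

signedHits-hit : ∀ k → signedHits (triangular k) k ≡ signCeilHalf k
signedHits-hit k =
  trans (cong (signCeilHalf k *_) (if-yes (triangular k ℕ.≟ triangular k) refl)) (ℤP.*-identityʳ (signCeilHalf k))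

signedHits-miss : ∀ {i} k → triangular k ≢ i → signedHits i k ≡ + 0
signedHits-miss {i} k t≢i =
  trans (cong (signCeilHalf k *_) (if-no (triangular k ℕ.≟ i) t≢i)) (ℤP.*-zeroʳ (signCeilHalf k))

sum-signedHits : ∀ K i → i < K → sumℤ K (signedHits i) ≡ theta Alternating.χ i
sum-signedHits K i i<K with ℕP.anyUpTo? (λ k → triangular k ℕ.≟ i) (suc i)
... | yes (k₀ , _ , refl) = begin
  sumℤ K (signedHits i)       ≡⟨ sum-single K k₀ (ℕP.≤-<-trans (k≤triangular k₀) i<K) off ⟩
  signedHits i k₀             ≡⟨ signedHits-hit k₀ ⟩
  signCeilHalf k₀             ≡⟨ cong signCeilHalf (sym (zigzag-unzigzag k₀)) ⟩
  signCeilHalf (zigzag n₀)    ≡⟨ signCeilHalf-zigzag n₀ ⟩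
  Alternating.χ n₀            ≡⟨ sym (theta-hit Alternating.χ n₀) ⟩
  theta Alternating.χ (triangular (zigzag n₀)) ≡⟨ cong (λ k → theta Alternating.χ (triangular k)) (zigzag-unzigzag k₀) ⟩
  theta Alternating.χ i       ∎
  where
  open ≡-Reasoning
  n₀ = unzigzag k₀
  off : ∀ k → k < K → k ≢ k₀ → signedHits i k ≡ + 0
  off k _ k≢k₀ = signedHits-miss k (k≢k₀ ∘ triangular-injective)
... | no ¬triangular = trans (sum-zero K (λ k _ → signedHits-miss k (miss k))) (sym (theta-miss Alternating.χ i (miss ∘ zigzag)))
  where
  miss : ∀ k → triangular k ≢ i
  miss k eq = ¬triangular (k , s≤s (subst (k ℕ.≤_) eq (k≤triangular k)) , eq)

term-as-sum : ∀ n k → term n k ≡ sumℤ (suc n) (λ i → signedHits i k * opSeries (suc n ℕ.* 2) (n ∸ i))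
term-as-sum n k =
  trans (cong (λ t → if does (t ≤? n) then signCeilHalf k * + pbarO (n ∸ t) else + 0) (tri≡triangular k))
        (by-cases (t ≤? n))
  where
  t = triangular k
  P = opSeries (suc n ℕ.* 2)
  by-cases : (d : Dec (t ℕ.≤ n)) →
    (if does d then signCeilHalf k * + pbarO (n ∸ t) else + 0) ≡ sumℤ (suc n) (λ i → signedHits i k * P (n ∸ i))
  by-cases (yes t≤n) = sym (begin
    sumℤ (suc n) (λ i → signedHits i k * P (n ∸ i))
      ≡⟨ sum-single (suc n) t (s≤s t≤n) (λ i _ i≢t → cong (_* P (n ∸ i)) (signedHits-miss k (i≢t ∘ sym))) ⟩
    signedHits t k * P (n ∸ t)
      ≡⟨ cong₂ (λ x y → x * + y) (signedHits-hit k) (opBounded-stable n∸t≤J) ⟩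
    signCeilHalf k * + pbarO (n ∸ t) ∎)
    where
    open ≡-Reasoning
    n∸t≤J : n ∸ t ℕ.≤ suc n ℕ.* 2
    n∸t≤J = ℕP.≤-trans (ℕP.m∸n≤m n t) (ℕP.≤-trans (ℕP.n≤1+n n) (ℕP.m≤m*n (suc n) 2))
  by-cases (no t≰n) = sym (sum-zero (suc n) (λ i i≤n → cong (_* P (n ∸ i))
    (signedHits-miss k (λ t≡i → t≰n (subst (ℕ._≤ n) (sym t≡i) (ℕP.≤-pred i≤n))))))

sum-term : ∀ n K → n < K → sumℤ K (term n) ≡ theta Constant.χ n
sum-term n K n<K = begin
  sumℤ K (term n)
    ≡⟨ sum-ext K (term-as-sum n) ⟩
  sumℤ K (λ k → sumℤ (suc n) (λ i → signedHits i k * P (n ∸ i)))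
    ≡⟨ sum-comm K (suc n) (λ k i → signedHits i k * P (n ∸ i)) ⟩
  sumℤ (suc n) (λ i → sumℤ K (λ k → signedHits i k * P (n ∸ i)))
    ≡⟨ sum-cong (suc n) (λ i i≤n → trans (sum-*ʳ K (P (n ∸ i)) (signedHits i))
                                       (cong (_* P (n ∸ i)) (sum-signedHits K i (ℕP.<-≤-trans i≤n n<K)))) ⟩
  (theta Alternating.χ ⊛ P) n
    ≡⟨ ⊛-comm (theta Alternating.χ) P n ⟩
  (P ⊛ theta Alternating.χ) n
    ≡⟨ opSeries-⊛-theta n ⟩
  theta Constant.χ n ∎
  where
  open ≡-Reasoning
  P = opSeries (suc n ℕ.* 2)

theorem1p4 : (n K : ℕ) → n < K →
    ((∃ λ m → n ≡ tri m) → sumℤ K (term n) ≡ + 1) ×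
    (¬ (∃ λ m → n ≡ tri m) → sumℤ K (term n) ≡ + 0)
theorem1p4 n K n<K = triangular-case , non-triangular-case
  where
  open ≡-Reasoning
  triangular-case : (∃ λ m → n ≡ tri m) → sumℤ K (term n) ≡ + 1
  triangular-case (m , n≡tri) = begin
    sumℤ K (term n)                                  ≡⟨ sum-term n K n<K ⟩
    theta Constant.χ n                               ≡⟨ cong (theta Constant.χ) n≡triangular ⟩
    theta Constant.χ (triangular (zigzag (unzigzag m))) ≡⟨ theta-hit Constant.χ (unzigzag m) ⟩
    (+ 1) ^ ℤ.∣ unzigzag m ∣                         ≡⟨ ℤP.^-zeroˡ ℤ.∣ unzigzag m ∣ ⟩
    + 1                                              ∎
    where
    n≡triangular : n ≡ triangular (zigzag (unzigzag m))
    n≡triangular = trans n≡tri (trans (tri≡triangular m) (cong triangular (sym (zigzag-unzigzag m))))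
  non-triangular-case : ¬ (∃ λ m → n ≡ tri m) → sumℤ K (term n) ≡ + 0
  non-triangular-case ¬triangular = trans (sum-term n K n<K) (theta-miss Constant.χ n miss)
    where
    miss : ∀ n′ → triangular (zigzag n′) ≢ n
    miss n′ eq = ¬triangular (zigzag n′ , sym (trans (tri≡triangular (zigzag n′)) eq))
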